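{- Let $w_{n,k}$ be the number of dispersed Dyck paths of length $n$ containing exactly $k$ occurrences of $UUDD$ (as four consecutive steps), and let $f_0(z,t)=\sum_{n,k}w_{n,k}z^nt^k$. Then \[ f_0(z,t)=\frac{ -z^4-1+z^4t+2z+\sqrt{z^8-2z^8t+2z^4+z^8t^2-2z^4t+1-4z^2}}{2z\,(-z^4t+1-2z+z^4)}. \] In particular, the generating function of dispersed Dyck paths avoiding $UUDD$ is \[ f_0(z,0)=\frac{2z+\sqrt{z^8+2z^4+1-4z^2}-z^4-1}{2z(1-2z+z^4)}, \] and the generating function of the total number of occurrences of $UUDD$ in dispersed Dyck paths of length $n$ is \[ \frac{\partial f_0}{\partial t}\Big|_{t=1}=\frac{z^4}{(1-2z)\sqrt{1-4z^2}}. \]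
   Context: A dispersed Dyck path of length $n$ is a sequence of $n$ steps, each an up-step $U=(1,1)$, a down-step $D=(1,-1)$, or a flat step $H=(1,0)$, starting at $(0,0)$, ending on the $x$-axis, never going below the $x$-axis, such that flat steps occur only on the $x$-axis. An occurrence of $UUDD$ is a position where four consecutive steps of the path are $U,U,D,D$. -}

module Defs where

open import Data.Nat using (ℕ; zero; suc; _∸_; _≡ᵇ_)
open import Data.Bool using (Bool; true; false; _∧_; if_then_else_)
open import Data.List using (List; []; _∷_; map; concatMap)
open import Data.Nat.ListAction using (sum)
open import Data.Integer using (ℤ; +_; -[1+_]) renaming (_+_ to _+ℤ_; _*_ to _*ℤ_; -_ to -ℤ_)
open import Data.Product using (_×_)
open import Relation.Binary.PropositionalEquality using (_≡_)

data Step : Set where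
  U D H : Step

allWords : ℕ → List (List Step)
allWords zero    = [] ∷ []
allWords (suc n) = concatMap (λ s → map (s ∷_) (allWords n)) (U ∷ D ∷ H ∷ [])

dispersedFrom : ℕ → List Step → Bool
dispersedFrom zero    []      = true
dispersedFrom (suc h) []      = false
dispersedFrom h       (U ∷ p) = dispersedFrom (suc h) p
dispersedFrom zero    (D ∷ p) = false
dispersedFrom (suc h) (D ∷ p) = dispersedFrom h p
dispersedFrom zero    (H ∷ p) = dispersedFrom zero p
dispersedFrom (suc h) (H ∷ p) = false

isDispersed : List Step → Bool
isDispersed = dispersedFrom zero

occUUDD : List Step → ℕ
occUUDD (U ∷ U ∷ D ∷ D ∷ p) = suc (occUUDD (U ∷ D ∷ D ∷ p))
occUUDD []      = 0
occUUDD (_ ∷ p) = occUUDD p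

w : ℕ → ℕ → ℕ
w n k = sum (map (λ p → if isDispersed p ∧ (occUUDD p ≡ᵇ k) then 1 else 0) (allWords n))

totalUUDD : ℕ → ℕ
totalUUDD n = sum (map (λ p → if isDispersed p then occUUDD p else 0) (allWords n))

sumTo : ℕ → (ℕ → ℤ) → ℤ
sumTo zero    f = f zero
sumTo (suc n) f = sumTo n f +ℤ f (suc n)

Series : Set
Series = ℕ → ℤ

-- bivariate series in z,t: (F n k) is the coefficient of z^n t^k
BSeries : Set
BSeries = ℕ → ℕ → ℤ

infixl 6 _⊕_ _⊕₂_
infixl 7 _⊗_ _⊗₂_
infix 4 _≋_ _≋₂_

_⊕_ : Series → Series → Series
(f ⊕ g) n = f n +ℤ g n

_⊗_ : Series → Series → Series
(f ⊗ g) n = sumTo n (λ i → f i *ℤ g (n ∸ i))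

_≋_ : Series → Series → Set
f ≋ g = ∀ n → f n ≡ g n

_⊕₂_ : BSeries → BSeries → BSeries
(f ⊕₂ g) n k = f n k +ℤ g n k

_⊗₂_ : BSeries → BSeries → BSeries
(f ⊗₂ g) n k = sumTo n (λ i → sumTo k (λ j → f i j *ℤ g (n ∸ i) (k ∸ j)))

_≋₂_ : BSeries → BSeries → Set
f ≋₂ g = ∀ n k → f n k ≡ g n k

mono : ℤ → ℕ → Series
mono c a n = if n ≡ᵇ a then c else + 0

mono₂ : ℤ → ℕ → ℕ → BSeries
mono₂ c a b n k = if (n ≡ᵇ a) ∧ (k ≡ᵇ b) then c else + 0

f₀ : BSeries
f₀ n k = + w n k

f₀at0 : Series
f₀at0 n = + w n 0

-- ∂f₀/∂t at t=1 : Σ_n (total # of UUDD over paths of length n) z^n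
f₀dt1 : Series
f₀dt1 n = + totalUUDD n

m2 m4 : ℤ
m2 = -[1+ 1 ]
m4 = -[1+ 3 ]
m1 : ℤ
m1 = -[1+ 0 ]

numPoly : BSeries
numPoly = mono₂ m1 4 0 ⊕₂ mono₂ m1 0 0 ⊕₂ mono₂ (+ 1) 4 1 ⊕₂ mono₂ (+ 2) 1 0

-- denominator 2z(-z^4 t + 1 - 2z + z^4) = -2z^5 t + 2z - 4z^2 + 2z^5
denPoly : BSeries
denPoly = mono₂ m2 5 1 ⊕₂ mono₂ (+ 2) 1 0 ⊕₂ mono₂ m4 2 0 ⊕₂ mono₂ (+ 2) 5 0

discPoly : BSeries
discPoly = mono₂ (+ 1) 8 0 ⊕₂ mono₂ m2 8 1 ⊕₂ mono₂ (+ 2) 4 0 ⊕₂ mono₂ (+ 1) 8 2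
           ⊕₂ mono₂ m2 4 1 ⊕₂ mono₂ (+ 1) 0 0 ⊕₂ mono₂ m4 2 0

numPoly0 : Series
numPoly0 = mono (+ 2) 1 ⊕ mono m1 4 ⊕ mono m1 0

-- 2z(1 - 2z + z^4) = 2z - 4z^2 + 2z^5
denPoly0 : Series
denPoly0 = mono (+ 2) 1 ⊕ mono m4 2 ⊕ mono (+ 2) 5

discPoly0 : Series
discPoly0 = mono (+ 1) 8 ⊕ mono (+ 2) 4 ⊕ mono (+ 1) 0 ⊕ mono m4 2

oneMinus2z : Series
oneMinus2z = mono (+ 1) 0 ⊕ mono m2 1

oneMinus4z2 : Series
oneMinus4z2 = mono (+ 1) 0 ⊕ mono m4 2

z⁴ : Series
z⁴ = mono (+ 1) 4

-- Square roots of power series: √P is the unique series with constant term 1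
-- whose square is P (P having constant term 1).

IsSqrt₂ : BSeries → BSeries → Set
IsSqrt₂ S P = (∀ k → S 0 k ≡ (if k ≡ᵇ 0 then + 1 else + 0)) × (S ⊗₂ S ≋₂ P)

IsSqrt : Series → Series → Set
IsSqrt S P = (S 0 ≡ + 1) × (S ⊗ S ≋ P)

{-# OPTIONS --safe #-}
module Submission where

-- Let B(z,t) count Dyck paths (dispersed paths without flat steps) by length and number of UUDD.
-- Cutting a nonempty Dyck path at its first return to the axis, U P D r, gives B = 1 + z²B′B, where
-- B′ = B + z²(t − 1) counts P by the occurrences in U P D (only P = UD creates a new one); cutting a
-- dispersed path at its first flat step gives f₀ = B + zBf₀.  Hence z²B² + (z⁴(t − 1) − 1)B + 1 = 0,
-- so S = 1 + z⁴ − z⁴t − 2z²B squares to the discriminant, and (1 − zB)f₀ = B turns into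
-- denominator · f₀ = numerator + S; setting t = 0 specialises both.  Weighting the same two cuts by 1
-- and by the number of occurrences gives, for the Catalan series C = 1 + z²C² and
-- Q = 1 − 2z²C = √(1 − 4z²), the relations Bₜ Q = z⁴C, Fₜ(1 − zC) = Bₜ(1 + zF₁),
-- (1 − zC)(1 + zF₁) = 1 and (1 − zC)² = (1 − 2z)C, which combine to (1 − 2z) Q Fₜ = z⁴.
-- The counts are finite sums over the 3ⁿ words of length n; every identity above holds in ℤ[[z]] or
-- ℤ[[t]][[z]] as an explicit polynomial combination of the functional equations.

open import Defs
open import Algebra.Bundles using (CommutativeSemiring; CommutativeRing; RawRing)
open import Algebra.Solver.Ring.AlmostCommutativeRing
  using (fromCommutativeRing; _-Raw-AlmostCommutative⟶_; -raw-almostCommutative⟶; Induced-equivalence)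
open import Data.Bool.Base using (if_then_else_)
open import Data.Nat.Base as ℕ using (ℕ; zero; suc; _∸_; _≤_; _<_; z≤n; s≤s; _≡ᵇ_)
import Data.Nat.Properties as ℕ
open import Data.Product.Base using (_×_; _,_; ∃-syntax; proj₁; proj₂)
import Relation.Binary.PropositionalEquality as ≡
import Algebra.Properties.Semiring.Exp
import Algebra.Solver.Ring
import Data.Fin.Base as Fin

module RangeSums {c ℓ} (S : CommutativeSemiring c ℓ) where

  open CommutativeSemiring S hiding (zero)
  open import Relation.Binary.Reasoning.Setoid setoid
  open import Algebra.Properties.CommutativeSemigroup +-commutativeSemigroup using (interchange)

  ∑≤ : ℕ → (ℕ → Carrier) → Carrier
  ∑≤ zero    f = f zero
  ∑≤ (suc n) f = ∑≤ n f + f (suc n)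

  ∑≤-cong-≤ : ∀ n {f g} → (∀ i → i ≤ n → f i ≈ g i) → ∑≤ n f ≈ ∑≤ n g
  ∑≤-cong-≤ zero    f≈g = f≈g zero z≤n
  ∑≤-cong-≤ (suc n) f≈g =
    +-cong (∑≤-cong-≤ n (λ i i≤n → f≈g i (ℕ.m≤n⇒m≤1+n i≤n))) (f≈g (suc n) ℕ.≤-refl)

  ∑≤-cong : ∀ n {f g} → (∀ i → f i ≈ g i) → ∑≤ n f ≈ ∑≤ n g
  ∑≤-cong n f≈g = ∑≤-cong-≤ n (λ i _ → f≈g i)

  ∑≤-distrib-+ : ∀ n f g → ∑≤ n (λ i → f i + g i) ≈ ∑≤ n f + ∑≤ n g
  ∑≤-distrib-+ zero    f g = refl
  ∑≤-distrib-+ (suc n) f g =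
    trans (+-congʳ (∑≤-distrib-+ n f g)) (interchange _ _ _ _)

  ∑≤-zero : ∀ n → ∑≤ n (λ _ → 0#) ≈ 0#
  ∑≤-zero zero    = refl
  ∑≤-zero (suc n) = trans (+-identityʳ _) (∑≤-zero n)

  ∑≤-suc : ∀ n f → ∑≤ (suc n) f ≈ f 0 + ∑≤ n (λ i → f (suc i))
  ∑≤-suc zero    f = refl
  ∑≤-suc (suc n) f = trans (+-congʳ (∑≤-suc n f)) (+-assoc _ _ _)

  ∑≤-reverse : ∀ n f → ∑≤ n f ≈ ∑≤ n (λ i → f (n ∸ i))
  ∑≤-reverse zero    f = refl
  ∑≤-reverse (suc n) f = begin
    ∑≤ (suc n) f
      ≈⟨ ∑≤-suc n f ⟩
    f 0 + ∑≤ n (λ i → f (suc i))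
      ≈⟨ +-comm _ _ ⟩
    ∑≤ n (λ i → f (suc i)) + f 0
      ≈⟨ +-cong (∑≤-reverse n (λ i → f (suc i))) (reflexive (≡.cong f (≡.sym (ℕ.n∸n≡0 (suc n))))) ⟩
    ∑≤ n (λ i → f (suc (n ∸ i))) + f (suc n ∸ suc n)
      ≈⟨ +-congʳ (∑≤-cong-≤ n (λ i i≤n → reflexive (≡.cong f (≡.sym (ℕ.+-∸-assoc 1 i≤n))))) ⟩
    ∑≤ (suc n) (λ i → f (suc n ∸ i)) ∎

module FormalPowerSeries {c ℓ} (R : CommutativeRing c ℓ) where

  open CommutativeRing R hiding (zero)
  open RangeSums commutativeSemiring
  open import Relation.Binary.Reasoning.Setoid setoid
  open import Algebra.Properties.Ring ring using (-0#≈0#)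
  open import Algebra.Structures using (IsCommutativeRing)
  open import Algebra.Properties.Semiring.Exp semiring using (_^_)
  open import Relation.Binary.Structures using (IsEquivalence)

  PowerSeries : Set c
  PowerSeries = ℕ → Carrier

  infix  4 _≈ˢ_
  infixl 6 _+ˢ_
  infixl 7 _*ˢ_
  infix  8 -ˢ_

  _≈ˢ_ : PowerSeries → PowerSeries → Set ℓ
  f ≈ˢ g = ∀ n → f n ≈ g n

  _+ˢ_ _*ˢ_ : PowerSeries → PowerSeries → PowerSeries
  (f +ˢ g) n = f n + g n
  (f *ˢ g) n = ∑≤ n (λ i → f i * g (n ∸ i))

  -ˢ_ : PowerSeries → PowerSeries
  (-ˢ f) n = - f n

  C : Carrier → PowerSeries
  C a zero    = a
  C a (suc _) = 0#

  0ˢ 1ˢ X : PowerSeries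
  0ˢ _ = 0#
  1ˢ = C 1#
  X zero          = 0#
  X (suc zero)    = 1#
  X (suc (suc _)) = 0#

  shift : PowerSeries → PowerSeries
  shift f n = f (suc n)

  *ˢ-suc : ∀ f g n → (f *ˢ g) (suc n) ≈ f 0 * g (suc n) + (shift f *ˢ g) n
  *ˢ-suc f g n = ∑≤-suc n (λ i → f i * g (suc n ∸ i))

  *ˢ-cong : ∀ {f f′ g g′} → f ≈ˢ f′ → g ≈ˢ g′ → f *ˢ g ≈ˢ f′ *ˢ g′
  *ˢ-cong f≈f′ g≈g′ n = ∑≤-cong n (λ i → *-cong (f≈f′ i) (g≈g′ (n ∸ i)))

  *ˢ-comm : ∀ f g → f *ˢ g ≈ˢ g *ˢ f
  *ˢ-comm f g n = begin
    ∑≤ n (λ i → f i * g (n ∸ i))             ≈⟨ ∑≤-reverse n _ ⟩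
    ∑≤ n (λ i → f (n ∸ i) * g (n ∸ (n ∸ i))) ≈⟨ ∑≤-cong-≤ n (λ i i≤n → trans (*-comm _ _)
                                                   (*-congʳ (reflexive (≡.cong g (ℕ.m∸[m∸n]≡n i≤n))))) ⟩
    ∑≤ n (λ i → g i * f (n ∸ i))             ∎

  *ˢ-distribˡ : ∀ f g h → f *ˢ (g +ˢ h) ≈ˢ f *ˢ g +ˢ f *ˢ h
  *ˢ-distribˡ f g h n =
    trans (∑≤-cong n (λ i → distribˡ (f i) (g (n ∸ i)) (h (n ∸ i)))) (∑≤-distrib-+ n _ _)

  *ˢ-distribʳ : ∀ h f g → (f +ˢ g) *ˢ h ≈ˢ f *ˢ h +ˢ g *ˢ h
  *ˢ-distribʳ h f g n = begin
    ((f +ˢ g) *ˢ h) n       ≈⟨ *ˢ-comm (f +ˢ g) h n ⟩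
    (h *ˢ (f +ˢ g)) n       ≈⟨ *ˢ-distribˡ h f g n ⟩
    (h *ˢ f +ˢ h *ˢ g) n    ≈⟨ +-cong (*ˢ-comm h f n) (*ˢ-comm h g n) ⟩
    (f *ˢ h +ˢ g *ˢ h) n    ∎

  *ˢ-zeroˡ : ∀ f → 0ˢ *ˢ f ≈ˢ 0ˢ
  *ˢ-zeroˡ f n = trans (∑≤-cong n (λ i → zeroˡ _)) (∑≤-zero n)

  C-*ˢ : ∀ a f n → (C a *ˢ f) n ≈ a * f n
  C-*ˢ a f zero    = refl
  C-*ˢ a f (suc n) = begin
    (C a *ˢ f) (suc n)          ≈⟨ *ˢ-suc (C a) f n ⟩
    a * f (suc n) + (0ˢ *ˢ f) n ≈⟨ +-congˡ (*ˢ-zeroˡ f n) ⟩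
    a * f (suc n) + 0#          ≈⟨ +-identityʳ _ ⟩
    a * f (suc n)               ∎

  *ˢ-identityˡ : ∀ f → 1ˢ *ˢ f ≈ˢ f
  *ˢ-identityˡ f n = trans (C-*ˢ 1# f n) (*-identityˡ (f n))

  shift-*ˢ : ∀ f g → shift (f *ˢ g) ≈ˢ C (f 0) *ˢ shift g +ˢ shift f *ˢ g
  shift-*ˢ f g n = trans (*ˢ-suc f g n) (+-congʳ (sym (C-*ˢ (f 0) (shift g) n)))

  *ˢ-assoc : ∀ f g h → (f *ˢ g) *ˢ h ≈ˢ f *ˢ (g *ˢ h)
  *ˢ-assoc f g h zero    = *-assoc _ _ _
  *ˢ-assoc f g h (suc n) = begin
    ((f *ˢ g) *ˢ h) (suc n)
      ≈⟨ *ˢ-suc (f *ˢ g) h n ⟩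
    (f 0 * g 0) * h (suc n) + (shift (f *ˢ g) *ˢ h) n
      ≈⟨ +-congˡ (*ˢ-cong {g = h} (shift-*ˢ f g) (λ _ → refl) n) ⟩
    (f 0 * g 0) * h (suc n) + ((C (f 0) *ˢ shift g +ˢ shift f *ˢ g) *ˢ h) n
      ≈⟨ +-congˡ (*ˢ-distribʳ h (C (f 0) *ˢ shift g) (shift f *ˢ g) n) ⟩
    (f 0 * g 0) * h (suc n) + (((C (f 0) *ˢ shift g) *ˢ h) n + ((shift f *ˢ g) *ˢ h) n)
      ≈⟨ +-congˡ (+-cong (*ˢ-assoc (C (f 0)) (shift g) h n) (*ˢ-assoc (shift f) g h n)) ⟩
    (f 0 * g 0) * h (suc n) + ((C (f 0) *ˢ (shift g *ˢ h)) n + (shift f *ˢ (g *ˢ h)) n)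
      ≈⟨ +-congˡ (+-congʳ (C-*ˢ (f 0) (shift g *ˢ h) n)) ⟩
    (f 0 * g 0) * h (suc n) + (f 0 * (shift g *ˢ h) n + (shift f *ˢ (g *ˢ h)) n)
      ≈⟨ sym (+-assoc _ _ _) ⟩
    ((f 0 * g 0) * h (suc n) + f 0 * (shift g *ˢ h) n) + (shift f *ˢ (g *ˢ h)) n
      ≈⟨ +-congʳ (trans (+-congʳ (*-assoc _ _ _)) (sym (distribˡ _ _ _))) ⟩
    f 0 * (g 0 * h (suc n) + (shift g *ˢ h) n) + (shift f *ˢ (g *ˢ h)) n
      ≈⟨ +-congʳ (*-congˡ (sym (*ˢ-suc g h n))) ⟩
    f 0 * (g *ˢ h) (suc n) + (shift f *ˢ (g *ˢ h)) n
      ≈⟨ sym (*ˢ-suc f (g *ˢ h) n) ⟩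
    (f *ˢ (g *ˢ h)) (suc n) ∎

  ≈ˢ-isEquivalence : IsEquivalence _≈ˢ_
  ≈ˢ-isEquivalence = record
    { refl  = λ _ → refl
    ; sym   = λ f≈g n → sym (f≈g n)
    ; trans = λ f≈g g≈h n → trans (f≈g n) (g≈h n)
    }

  isCommutativeRingˢ : IsCommutativeRing _≈ˢ_ _+ˢ_ _*ˢ_ -ˢ_ 0ˢ 1ˢ
  isCommutativeRingˢ = record
    { isRing = record
      { +-isAbelianGroup = record
        { isGroup = record
          { isMonoid = record
            { isSemigroup = record
              { isMagma = record
                { isEquivalence = ≈ˢ-isEquivalence
                ; ∙-cong        = λ f≈f′ g≈g′ n → +-cong (f≈f′ n) (g≈g′ n)
                }
              ; assoc = λ f g h n → +-assoc (f n) (g n) (h n)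
              }
            ; identity = (λ f n → +-identityˡ (f n)) , (λ f n → +-identityʳ (f n))
            }
          ; inverse = (λ f n → -‿inverseˡ (f n)) , (λ f n → -‿inverseʳ (f n))
          ; ⁻¹-cong = λ f≈g n → -‿cong (f≈g n)
          }
        ; comm = λ f g n → +-comm (f n) (g n)
        }
      ; *-cong     = *ˢ-cong
      ; *-assoc    = *ˢ-assoc
      ; *-identity = *ˢ-identityˡ , (λ f n → trans (*ˢ-comm f 1ˢ n) (*ˢ-identityˡ f n))
      ; distrib    = *ˢ-distribˡ , *ˢ-distribʳ
      }
    ; *-comm = *ˢ-comm
    }

  R[[X]] : CommutativeRing c ℓ
  R[[X]] = record { isCommutativeRing = isCommutativeRingˢ }

  module Powers = Algebra.Properties.Semiring.Exp (CommutativeRing.semiring R[[X]])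

  infixr 8 _^ˢ_
  _^ˢ_ : PowerSeries → ℕ → PowerSeries
  _^ˢ_ = Powers._^_

  shift-X : shift X ≈ˢ 1ˢ
  shift-X zero    = refl
  shift-X (suc n) = refl

  X-*ˢ-zero : ∀ f → (X *ˢ f) 0 ≈ 0#
  X-*ˢ-zero f = zeroˡ (f 0)

  X-*ˢ-suc : ∀ f n → (X *ˢ f) (suc n) ≈ f n
  X-*ˢ-suc f n = begin
    (X *ˢ f) (suc n)                  ≈⟨ *ˢ-suc X f n ⟩
    0# * f (suc n) + (shift X *ˢ f) n ≈⟨ +-cong (zeroˡ _) (*ˢ-cong {g = f} shift-X (λ _ → refl) n) ⟩
    0# + (1ˢ *ˢ f) n                  ≈⟨ +-identityˡ _ ⟩
    (1ˢ *ˢ f) n                       ≈⟨ *ˢ-identityˡ f n ⟩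
    f n                               ∎

  X^suc-*ˢ-zero : ∀ d f → (X ^ˢ suc d *ˢ f) 0 ≈ 0#
  X^suc-*ˢ-zero d f = trans (*ˢ-assoc X (X ^ˢ d) f 0) (X-*ˢ-zero (X ^ˢ d *ˢ f))

  X^suc-*ˢ-suc : ∀ d f n → (X ^ˢ suc d *ˢ f) (suc n) ≈ (X ^ˢ d *ˢ f) n
  X^suc-*ˢ-suc d f n = trans (*ˢ-assoc X (X ^ˢ d) f (suc n)) (X-*ˢ-suc (X ^ˢ d *ˢ f) n)

  ≈ˢ-+X^*ˢ : ∀ d {f g h} → (∀ n → n < d → f n ≈ g n) →
             (∀ n → f (d ℕ.+ n) ≈ g (d ℕ.+ n) + h n) → f ≈ˢ g +ˢ X ^ˢ d *ˢ h
  ≈ˢ-+X^*ˢ zero    {f} {g} {h} _   f≈g+h n = trans (f≈g+h n) (+-congˡ (sym (*ˢ-identityˡ h n)))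
  ≈ˢ-+X^*ˢ (suc d) {f} {g} {h} f≈g _ zero = begin
    f 0                       ≈⟨ f≈g 0 (s≤s z≤n) ⟩
    g 0                       ≈⟨ sym (+-identityʳ _) ⟩
    g 0 + 0#                  ≈⟨ +-congˡ (sym (X^suc-*ˢ-zero d h)) ⟩
    g 0 + (X ^ˢ suc d *ˢ h) 0 ∎
  ≈ˢ-+X^*ˢ (suc d) {f} {g} {h} f≈g f≈g+h (suc n) = trans
    (≈ˢ-+X^*ˢ d {shift f} {shift g} {h} (λ m m<d → f≈g (suc m) (s≤s m<d)) f≈g+h n)
    (+-congˡ (sym (X^suc-*ˢ-suc d h n)))

  C*X^-coeff : ∀ a d n → (C a *ˢ X ^ˢ d) n ≈ (if n ≡ᵇ d then a else 0#)
  C*X^-coeff a d n = trans (*ˢ-comm (C a) (X ^ˢ d) n) (X^*C-coeff d n)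
    where
    X^*C-coeff : ∀ d n → (X ^ˢ d *ˢ C a) n ≈ (if n ≡ᵇ d then a else 0#)
    X^*C-coeff zero    n       = trans (*ˢ-identityˡ (C a) n) (C-if n)
      where
      C-if : ∀ n → C a n ≈ (if n ≡ᵇ 0 then a else 0#)
      C-if zero    = refl
      C-if (suc n) = refl
    X^*C-coeff (suc d) zero    = X^suc-*ˢ-zero d (C a)
    X^*C-coeff (suc d) (suc n) = trans (X^suc-*ˢ-suc d (C a) n) (X^*C-coeff d n)

  C-cong : ∀ {a b} → a ≈ b → C a ≈ˢ C b
  C-cong a≈b zero    = a≈b
  C-cong a≈b (suc n) = refl

  C-+ : ∀ a b → C (a + b) ≈ˢ C a +ˢ C b
  C-+ a b zero    = refl
  C-+ a b (suc n) = sym (+-identityʳ 0#)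

  C-* : ∀ a b → C (a * b) ≈ˢ C a *ˢ C b
  C-* a b zero    = refl
  C-* a b (suc n) = sym (trans (C-*ˢ a (C b) (suc n)) (zeroʳ a))

  C-‿- : ∀ a → C (- a) ≈ˢ -ˢ C a
  C-‿- a zero    = refl
  C-‿- a (suc n) = sym -0#≈0#

  C-0 : C 0# ≈ˢ 0ˢ
  C-0 zero    = refl
  C-0 (suc n) = refl

  C-^ : ∀ a d → C a ^ˢ d ≈ˢ C (a ^ d)
  C-^ a zero    n = refl
  C-^ a (suc d) n = trans (*ˢ-cong {f = C a} (λ _ → refl) (C-^ a d) n) (sym (C-* a (a ^ d) n))

  C-morphism : ∀ {r₁ r₂} {Coeff : RawRing r₁ r₂} →
               Coeff -Raw-AlmostCommutative⟶ fromCommutativeRing R →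
               Coeff -Raw-AlmostCommutative⟶ fromCommutativeRing R[[X]]
  C-morphism φ = record
    { ⟦_⟧    = λ x → C ⟦ x ⟧
    ; +-homo = λ x y n → trans (C-cong (+-homo x y) n) (C-+ _ _ n)
    ; *-homo = λ x y n → trans (C-cong (*-homo x y) n) (C-* _ _ n)
    ; -‿homo = λ x n → trans (C-cong (-‿homo x) n) (C-‿- _ n)
    ; 0-homo = λ n → trans (C-cong 0-homo n) (C-0 n)
    ; 1-homo = C-cong 1-homo
    }
    where open _-Raw-AlmostCommutative⟶_ φ

module Counting where

  open import Relation.Binary.PropositionalEquality
  open import Data.Bool.Base using (Bool; true; false)
  open import Data.Bool.Properties using (if-∧)
  open import Data.Empty using (⊥-elim)
  open import Data.List.Base using (List; []; _∷_; _++_; map; length)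
  open import Data.List.Properties using (map-++; map-∘; map-cong)
  open import Data.Nat.Base using (_+_; _*_)
  open import Data.Nat.ListAction using (sum)
  open import Data.Nat.ListAction.Properties using (sum-++)
  open import Data.Nat.Properties
    using (+-*-commutativeSemiring; +-commutativeSemigroup; +-assoc; +-identityʳ; *-identityˡ; *-identityʳ;
           *-zeroʳ; *-comm; *-distribˡ-+)
  open import Data.Nat.Solver using (module +-*-Solver)
  open import Data.Product.Base using (Σ)
  open import Function.Base using (_∘_)
  open import Algebra.Properties.CommutativeSemigroup +-commutativeSemigroup using (interchange)
  open ≡-Reasoning
  open RangeSums +-*-commutativeSemiring

  private
    variable
      A B : Set

  sumList : List A → (A → ℕ) → ℕ
  sumList xs f = sum (map f xs)

  sumList-++ : ∀ (xs ys : List A) f → sumList (xs ++ ys) f ≡ sumList xs f + sumList ys f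
  sumList-++ xs ys f = trans (cong sum (map-++ f xs ys)) (sum-++ (map f xs) (map f ys))

  sumList-map : ∀ (xs : List A) (g : A → B) f → sumList (map g xs) f ≡ sumList xs (f ∘ g)
  sumList-map xs g f = cong sum (sym (map-∘ xs))

  sumList-cong : ∀ (xs : List A) {f g} → (∀ x → f x ≡ g x) → sumList xs f ≡ sumList xs g
  sumList-cong xs f≗g = cong sum (map-cong f≗g xs)

  sumList-zero : ∀ (xs : List A) → sumList xs (λ _ → 0) ≡ 0
  sumList-zero []       = refl
  sumList-zero (x ∷ xs) = sumList-zero xs

  sumList-+ : ∀ (xs : List A) f g → sumList xs (λ x → f x + g x) ≡ sumList xs f + sumList xs g
  sumList-+ []       f g = refl
  sumList-+ (x ∷ xs) f g = begin
    (f x + g x) + sumList xs (λ x → f x + g x) ≡⟨ cong (f x + g x +_) (sumList-+ xs f g) ⟩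
    (f x + g x) + (sumList xs f + sumList xs g) ≡⟨ interchange (f x) (g x) _ _ ⟩
    (f x + sumList xs f) + (g x + sumList xs g) ∎

  sumList-*ˡ : ∀ (xs : List A) a f → sumList xs (λ x → a * f x) ≡ a * sumList xs f
  sumList-*ˡ []       a f = sym (*-zeroʳ a)
  sumList-*ˡ (x ∷ xs) a f = trans (cong (a * f x +_) (sumList-*ˡ xs a f)) (sym (*-distribˡ-+ a (f x) _))

  sumList-∑≤ : ∀ (xs : List A) k (F : A → ℕ → ℕ) →
               sumList xs (λ x → ∑≤ k (F x)) ≡ ∑≤ k (λ l → sumList xs (λ x → F x l))
  sumList-∑≤ xs zero    F = refl
  sumList-∑≤ xs (suc k) F =
    trans (sumList-+ xs _ _) (cong (_+ sumList xs (λ x → F x (suc k))) (sumList-∑≤ xs k F))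

  sumList-product : ∀ (xs : List A) (ys : List B) f g →
                    sumList xs (λ x → sumList ys (λ y → f x * g y)) ≡ sumList xs f * sumList ys g
  sumList-product xs ys f g = begin
    sumList xs (λ x → sumList ys (λ y → f x * g y)) ≡⟨ sumList-cong xs (λ x → sumList-*ˡ ys (f x) g) ⟩
    sumList xs (λ x → f x * sumList ys g)           ≡⟨ sumList-cong xs (λ x → *-comm (f x) (sumList ys g)) ⟩
    sumList xs (λ x → sumList ys g * f x)           ≡⟨ sumList-*ˡ xs (sumList ys g) f ⟩
    sumList ys g * sumList xs f                     ≡⟨ *-comm (sumList ys g) (sumList xs f) ⟩
    sumList xs f * sumList ys g                     ∎

  sumWords : ℕ → (List Step → ℕ) → ℕ
  sumWords n = sumList (allWords n)

  sumWords-zero : ∀ n → sumWords n (λ _ → 0) ≡ 0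
  sumWords-zero n = sumList-zero (allWords n)

  sumWords-suc : ∀ n g → sumWords (suc n) g ≡
    sumWords n (g ∘ (U ∷_)) + sumWords n (g ∘ (D ∷_)) + sumWords n (g ∘ (H ∷_))
  sumWords-suc n g = begin
    sumList (prefixed U ++ prefixed D ++ prefixed H ++ []) g
      ≡⟨ sumList-++ (prefixed U) _ g ⟩
    after U + sumList (prefixed D ++ prefixed H ++ []) g
      ≡⟨ cong (after U +_) (sumList-++ (prefixed D) _ g) ⟩
    after U + (after D + sumList (prefixed H ++ []) g)
      ≡⟨ cong (λ x → after U + (after D + x)) (trans (sumList-++ (prefixed H) [] g) (+-identityʳ _)) ⟩
    after U + (after D + after H)
      ≡⟨ sym (+-assoc (after U) _ _) ⟩
    after U + after D + after H
      ≡⟨ cong₂ _+_ (cong₂ _+_ (sumList-map W (U ∷_) g) (sumList-map W (D ∷_) g)) (sumList-map W (H ∷_) g) ⟩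
    sumWords n (g ∘ (U ∷_)) + sumWords n (g ∘ (D ∷_)) + sumWords n (g ∘ (H ∷_)) ∎
    where
    W : List (List Step)
    W = allWords n
    prefixed : Step → List (List Step)
    prefixed s = map (s ∷_) W
    after : Step → ℕ
    after s = sumList (prefixed s) g

  sumWords-length : ∀ n {g h} → (∀ p → length p ≡ n → g p ≡ h p) → sumWords n g ≡ sumWords n h
  sumWords-length zero    g≗h = cong (_+ 0) (g≗h [] refl)
  sumWords-length (suc n) {g} {h} g≗h = begin
    sumWords (suc n) g ≡⟨ sumWords-suc n g ⟩
    _                  ≡⟨ cong₂ _+_ (cong₂ _+_ (after U) (after D)) (after H) ⟩
    _                  ≡⟨ sym (sumWords-suc n h) ⟩
    sumWords (suc n) h ∎
    where
    after : ∀ s → sumWords n (g ∘ (s ∷_)) ≡ sumWords n (h ∘ (s ∷_))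
    after s = sumWords-length n (λ p len≡n → g≗h (s ∷ p) (cong suc len≡n))

  sumWhere : ℕ → (List Step → Bool) → (List Step → ℕ) → ℕ
  sumWhere n φ g = sumWords n (λ p → if φ p then g p else 0)

  sumWhere-suc : ∀ n φ g → sumWhere (suc n) φ g ≡
    sumWhere n (φ ∘ (U ∷_)) (g ∘ (U ∷_)) + sumWhere n (φ ∘ (D ∷_)) (g ∘ (D ∷_))
    + sumWhere n (φ ∘ (H ∷_)) (g ∘ (H ∷_))
  sumWhere-suc n φ g = sumWords-suc n _

  sumWhere-cong : ∀ n φ {g h} → (∀ p → φ p ≡ true → g p ≡ h p) → sumWhere n φ g ≡ sumWhere n φ h
  sumWhere-cong n φ {g} {h} g≗h = sumList-cong (allWords n) if-cong
    where
    if-cong : ∀ p → (if φ p then g p else 0) ≡ (if φ p then h p else 0)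
    if-cong p with φ p in φp
    ... | true  = g≗h p φp
    ... | false = refl

  sumWhere-+ : ∀ n φ g h → sumWhere n φ (λ p → g p + h p) ≡ sumWhere n φ g + sumWhere n φ h
  sumWhere-+ n φ g h = trans (sumList-cong (allWords n) if-+) (sumList-+ (allWords n) _ _)
    where
    if-+ : ∀ p → (if φ p then g p + h p else 0) ≡ (if φ p then g p else 0) + (if φ p then h p else 0)
    if-+ p with φ p
    ... | true  = refl
    ... | false = refl

  sumWhere-∑≤ : ∀ n φ k (F : List Step → ℕ → ℕ) →
                sumWhere n φ (λ p → ∑≤ k (F p)) ≡ ∑≤ k (λ l → sumWhere n φ (λ p → F p l))
  sumWhere-∑≤ n φ k F = trans (sumList-cong (allWords n) if-∑≤) (sumList-∑≤ (allWords n) k _)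
    where
    if-∑≤ : ∀ p → (if φ p then ∑≤ k (F p) else 0) ≡ ∑≤ k (λ l → if φ p then F p l else 0)
    if-∑≤ p with φ p
    ... | true  = refl
    ... | false = sym (∑≤-zero k)

  sumWhere-product : ∀ i j α β (f g : List Step → ℕ) →
    sumWhere i α (λ P → sumWhere j β (λ r → f P * g r)) ≡ sumWhere i α f * sumWhere j β g
  sumWhere-product i j α β f g =
    trans (sumList-cong (allWords i) if-*) (sumList-product (allWords i) (allWords j) _ _)
    where
    if-* : ∀ P → (if α P then sumWhere j β (λ r → f P * g r) else 0) ≡
                 sumWords j (λ r → (if α P then f P else 0) * (if β r then g r else 0))
    if-* P with α P
    ... | false = sym (sumWords-zero j)
    ... | true  = sumList-cong (allWords j) if-*ʳ
      where
      if-*ʳ : ∀ r → (if β r then f P * g r else 0) ≡ f P * (if β r then g r else 0)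
      if-*ʳ r with β r
      ... | true  = refl
      ... | false = sym (*-zeroʳ (f P))

  dyckFrom : ℕ → List Step → Bool
  dyckFrom h       (U ∷ p) = dyckFrom (suc h) p
  dyckFrom _       (H ∷ _) = false
  dyckFrom zero    []      = true
  dyckFrom (suc _) []      = false
  dyckFrom zero    (D ∷ _) = false
  dyckFrom (suc h) (D ∷ p) = dyckFrom h p

  isDyck : List Step → Bool
  isDyck = dyckFrom 0

  -- ∑split n F is the sum of F i j over i + 1 + j = n.
  ∑split : ℕ → (ℕ → ℕ → ℕ) → ℕ
  ∑split zero    F = 0
  ∑split (suc n) F = ∑≤ n (λ i → F i (n ∸ i))

  ∑split-suc : ∀ n F → ∑split (suc n) F ≡ F 0 n + ∑split n (λ i j → F (suc i) j)
  ∑split-suc zero    F = sym (+-identityʳ _)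
  ∑split-suc (suc n) F = ∑≤-suc n (λ i → F i (suc n ∸ i))

  ∑split-cong : ∀ n {F G} → (∀ i j → F i j ≡ G i j) → ∑split n F ≡ ∑split n G
  ∑split-cong zero    F≗G = refl
  ∑split-cong (suc n) F≗G = ∑≤-cong n (λ i → F≗G i (n ∸ i))

  ∑split-+ : ∀ n F G → ∑split n (λ i j → F i j + G i j) ≡ ∑split n F + ∑split n G
  ∑split-+ zero    F G = refl
  ∑split-+ (suc n) F G = ∑≤-distrib-+ n _ _

  ∑split-sumWords-zero : ∀ n → ∑split n (λ i _ → sumWords i (λ _ → 0)) ≡ 0
  ∑split-sumWords-zero zero    = refl
  ∑split-sumWords-zero (suc n) = trans (∑≤-cong n (λ i → sumWords-zero i)) (∑≤-zero n)

  ∑split-sumWhere-suc : ∀ n φ (G : ℕ → List Step → ℕ) →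
    ∑split (suc n) (λ i j → sumWhere i φ (G j)) ≡
    sumWhere 0 φ (G n) + (∑split n (λ i j → sumWhere i (φ ∘ (U ∷_)) (G j ∘ (U ∷_)))
                          + ∑split n (λ i j → sumWhere i (φ ∘ (D ∷_)) (G j ∘ (D ∷_)))
                          + ∑split n (λ i j → sumWhere i (φ ∘ (H ∷_)) (G j ∘ (H ∷_))))
  ∑split-sumWhere-suc n φ G = begin
    ∑split (suc n) (λ i j → sumWhere i φ (G j))
      ≡⟨ ∑split-suc n (λ i j → sumWhere i φ (G j)) ⟩
    sumWhere 0 φ (G n) + ∑split n (λ i j → sumWhere (suc i) φ (G j))
      ≡⟨ cong (sumWhere 0 φ (G n) +_) (∑split-cong n (λ i j → sumWhere-suc i φ (G j))) ⟩
    sumWhere 0 φ (G n) + ∑split n (λ i j → after U i j + after D i j + after H i j)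
      ≡⟨ cong (sumWhere 0 φ (G n) +_) (∑split-+ n (λ i j → after U i j + after D i j) (after H)) ⟩
    sumWhere 0 φ (G n) + (∑split n (λ i j → after U i j + after D i j) + ∑split n (after H))
      ≡⟨ cong (λ x → sumWhere 0 φ (G n) + (x + ∑split n (after H))) (∑split-+ n (after U) (after D)) ⟩
    sumWhere 0 φ (G n) + (∑split n (after U) + ∑split n (after D) + ∑split n (after H)) ∎
    where
    after : Step → ℕ → ℕ → ℕ
    after s i j = sumWhere i (φ ∘ (s ∷_)) (G j ∘ (s ∷_))

  -- A path from height 1 + m is cut at its first step down to the axis; the part before it is
  -- read one level lower.
  first-passage : ∀ n m g → sumWhere n (dyckFrom (suc m)) g ≡
    ∑split n (λ i j → sumWhere i (dyckFrom m) (λ P → sumWhere j isDyck (λ r → g (P ++ D ∷ r))))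
  first-passage zero    m       g = refl
  first-passage (suc n) zero    g = begin
    sumWhere (suc n) (dyckFrom 1) g
      ≡⟨ sumWhere-suc n (dyckFrom 1) g ⟩
    sumWhere n (dyckFrom 2) (g ∘ (U ∷_)) + returned + sumWords n (λ _ → 0)
      ≡⟨ cong₂ _+_ (cong (_+ returned) (first-passage n 1 (g ∘ (U ∷_)))) (sumWords-zero n) ⟩
    climbing + returned + 0
      ≡⟨ solve 2 (λ a b → a :+ b :+ con 0 := (b :+ con 0) :+ (a :+ con 0 :+ con 0)) refl climbing returned ⟩
    (returned + 0) + (climbing + 0 + 0)
      ≡⟨ cong (λ x → (returned + 0) + (climbing + x + x)) (sym (∑split-sumWords-zero n)) ⟩
    (returned + 0) + (climbing + ∑split n (λ i j → sumWhere i (isDyck ∘ (D ∷_)) (G j ∘ (D ∷_)))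
                               + ∑split n (λ i j → sumWhere i (isDyck ∘ (H ∷_)) (G j ∘ (H ∷_))))
      ≡⟨ sym (∑split-sumWhere-suc n isDyck G) ⟩
    ∑split (suc n) (λ i j → sumWhere i isDyck (G j)) ∎
    where
    open +-*-Solver
    G : ℕ → List Step → ℕ
    G j P = sumWhere j isDyck (λ r → g (P ++ D ∷ r))
    returned climbing : ℕ
    returned = sumWhere n isDyck (g ∘ (D ∷_))
    climbing = ∑split n (λ i j → sumWhere i (dyckFrom 1) (G j ∘ (U ∷_)))
  first-passage (suc n) (suc m) g = begin
    sumWhere (suc n) (dyckFrom (2 + m)) g
      ≡⟨ sumWhere-suc n (dyckFrom (2 + m)) g ⟩
    sumWhere n (dyckFrom (3 + m)) (g ∘ (U ∷_)) + sumWhere n (dyckFrom (suc m)) (g ∘ (D ∷_))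
      + sumWords n (λ _ → 0)
      ≡⟨ cong₂ _+_ (cong₂ _+_ (first-passage n (2 + m) (g ∘ (U ∷_))) (first-passage n m (g ∘ (D ∷_))))
                   (sumWords-zero n) ⟩
    climbing + descending + 0
      ≡⟨ cong (climbing + descending +_) (sym (∑split-sumWords-zero n)) ⟩
    climbing + descending + ∑split n (λ i j → sumWhere i (dyckFrom (suc m) ∘ (H ∷_)) (G j ∘ (H ∷_)))
      ≡⟨ sym (∑split-sumWhere-suc n (dyckFrom (suc m)) G) ⟩
    ∑split (suc n) (λ i j → sumWhere i (dyckFrom (suc m)) (G j)) ∎
    where
    G : ℕ → List Step → ℕ
    G j P = sumWhere j isDyck (λ r → g (P ++ D ∷ r))
    climbing descending : ℕ
    climbing   = ∑split n (λ i j → sumWhere i (dyckFrom (2 + m)) (G j ∘ (U ∷_)))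
    descending = ∑split n (λ i j → sumWhere i (dyckFrom m) (G j ∘ (D ∷_)))

  first-return : ∀ m g → sumWhere (suc m) isDyck g ≡
    ∑split m (λ i j → sumWhere i isDyck (λ P → sumWhere j isDyck (λ r → g (U ∷ P ++ D ∷ r))))
  first-return m g = begin
    sumWhere (suc m) isDyck g
      ≡⟨ sumWhere-suc m isDyck g ⟩
    sumWhere m (dyckFrom 1) (g ∘ (U ∷_)) + sumWords m (λ _ → 0) + sumWords m (λ _ → 0)
      ≡⟨ cong₂ _+_ (cong₂ _+_ (first-passage m 0 (g ∘ (U ∷_))) (sumWords-zero m)) (sumWords-zero m) ⟩
    returns + 0 + 0
      ≡⟨ trans (+-identityʳ _) (+-identityʳ _) ⟩
    returns ∎
    where
    returns : ℕ
    returns = ∑split m (λ i j → sumWhere i isDyck (λ P → sumWhere j isDyck (λ r → g (U ∷ P ++ D ∷ r))))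

  first-flat : ∀ n h g → sumWhere n (dispersedFrom h) g ≡ sumWhere n (dyckFrom h) g +
    ∑split n (λ i j → sumWhere i (dyckFrom h) (λ P → sumWhere j isDispersed (λ r → g (P ++ H ∷ r))))
  first-flat zero    zero    g = sym (+-identityʳ _)
  first-flat zero    (suc h) g = refl
  first-flat (suc n) zero    g = begin
    sumWhere (suc n) isDispersed g
      ≡⟨ sumWhere-suc n isDispersed g ⟩
    sumWhere n (dispersedFrom 1) (g ∘ (U ∷_)) + sumWords n (λ _ → 0) + flat
      ≡⟨ cong₂ _+_ (cong₂ _+_ (first-flat n 1 (g ∘ (U ∷_))) (sumWords-zero n)) refl ⟩
    (climbing + climbingSplit) + 0 + flat
      ≡⟨ solve 3 (λ a b c → (a :+ b) :+ con 0 :+ c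
                             := (a :+ con 0 :+ con 0) :+ ((c :+ con 0) :+ (b :+ con 0 :+ con 0)))
           refl climbing climbingSplit flat ⟩
    (climbing + 0 + 0) + ((flat + 0) + (climbingSplit + 0 + 0))
      ≡⟨ cong₂ (λ x y → (climbing + x + x) + ((flat + 0) + (climbingSplit + y + y)))
           (sym (sumWords-zero n)) (sym (∑split-sumWords-zero n)) ⟩
    (climbing + sumWords n (λ _ → 0) + sumWords n (λ _ → 0))
      + ((flat + 0) + (climbingSplit + ∑split n (λ i _ → sumWords i (λ _ → 0))
                                     + ∑split n (λ i _ → sumWords i (λ _ → 0))))
      ≡⟨ cong₂ _+_ (sym (sumWhere-suc n isDyck g)) (sym (∑split-sumWhere-suc n isDyck G)) ⟩
    sumWhere (suc n) isDyck g + ∑split (suc n) (λ i j → sumWhere i isDyck (G j)) ∎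
    where
    open +-*-Solver
    G : ℕ → List Step → ℕ
    G j P = sumWhere j isDispersed (λ r → g (P ++ H ∷ r))
    flat climbing climbingSplit : ℕ
    flat          = sumWhere n isDispersed (g ∘ (H ∷_))
    climbing      = sumWhere n (dyckFrom 1) (g ∘ (U ∷_))
    climbingSplit = ∑split n (λ i j → sumWhere i (dyckFrom 1) (G j ∘ (U ∷_)))
  first-flat (suc n) (suc h) g = begin
    sumWhere (suc n) (dispersedFrom (suc h)) g
      ≡⟨ sumWhere-suc n (dispersedFrom (suc h)) g ⟩
    sumWhere n (dispersedFrom (2 + h)) (g ∘ (U ∷_)) + sumWhere n (dispersedFrom h) (g ∘ (D ∷_))
      + sumWords n (λ _ → 0)
      ≡⟨ cong₂ _+_ (cong₂ _+_ (first-flat n (2 + h) (g ∘ (U ∷_))) (first-flat n h (g ∘ (D ∷_))))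
                   (sumWords-zero n) ⟩
    (climbing + climbingSplit) + (descending + descendingSplit) + 0
      ≡⟨ solve 4 (λ a b c d → (a :+ b) :+ (c :+ d) :+ con 0 := (a :+ c :+ con 0) :+ (con 0 :+ (b :+ d :+ con 0)))
           refl climbing climbingSplit descending descendingSplit ⟩
    (climbing + descending + 0) + (0 + (climbingSplit + descendingSplit + 0))
      ≡⟨ cong₂ (λ x y → (climbing + descending + x) + (0 + (climbingSplit + descendingSplit + y)))
           (sym (sumWords-zero n)) (sym (∑split-sumWords-zero n)) ⟩
    (climbing + descending + sumWords n (λ _ → 0))
      + (0 + (climbingSplit + descendingSplit + ∑split n (λ i _ → sumWords i (λ _ → 0))))
      ≡⟨ cong₂ _+_ (sym (sumWhere-suc n (dyckFrom (suc h)) g))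
                   (sym (∑split-sumWhere-suc n (dyckFrom (suc h)) G)) ⟩
    sumWhere (suc n) (dyckFrom (suc h)) g + ∑split (suc n) (λ i j → sumWhere i (dyckFrom (suc h)) (G j)) ∎
    where
    open +-*-Solver
    G : ℕ → List Step → ℕ
    G j P = sumWhere j isDispersed (λ r → g (P ++ H ∷ r))
    climbing climbingSplit descending descendingSplit : ℕ
    climbing        = sumWhere n (dyckFrom (2 + h)) (g ∘ (U ∷_))
    climbingSplit   = ∑split n (λ i j → sumWhere i (dyckFrom (2 + h)) (G j ∘ (U ∷_)))
    descending      = sumWhere n (dyckFrom h) (g ∘ (D ∷_))
    descendingSplit = ∑split n (λ i j → sumWhere i (dyckFrom h) (G j ∘ (D ∷_)))

  startsUUDD : List Step → ℕ
  startsUUDD (U ∷ U ∷ D ∷ D ∷ _) = 1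
  startsUUDD _                   = 0

  occUUDD-∷ : ∀ s p → occUUDD (s ∷ p) ≡ startsUUDD (s ∷ p) + occUUDD p
  occUUDD-∷ D p                 = refl
  occUUDD-∷ H p                 = refl
  occUUDD-∷ U []                = refl
  occUUDD-∷ U (D ∷ p)           = refl
  occUUDD-∷ U (H ∷ p)           = refl
  occUUDD-∷ U (U ∷ [])          = refl
  occUUDD-∷ U (U ∷ U ∷ p)       = refl
  occUUDD-∷ U (U ∷ H ∷ p)       = refl
  occUUDD-∷ U (U ∷ D ∷ [])      = refl
  occUUDD-∷ U (U ∷ D ∷ U ∷ p)   = refl
  occUUDD-∷ U (U ∷ D ∷ H ∷ p)   = refl
  occUUDD-∷ U (U ∷ D ∷ D ∷ p)   = refl

  startsUUDD-++H : ∀ s P r → startsUUDD (s ∷ P ++ H ∷ r) ≡ startsUUDD (s ∷ P)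
  startsUUDD-++H D P                 r = refl
  startsUUDD-++H H P                 r = refl
  startsUUDD-++H U []                r = refl
  startsUUDD-++H U (D ∷ P)           r = refl
  startsUUDD-++H U (H ∷ P)           r = refl
  startsUUDD-++H U (U ∷ [])          r = refl
  startsUUDD-++H U (U ∷ U ∷ P)       r = refl
  startsUUDD-++H U (U ∷ H ∷ P)       r = refl
  startsUUDD-++H U (U ∷ D ∷ [])      r = refl
  startsUUDD-++H U (U ∷ D ∷ U ∷ P)   r = refl
  startsUUDD-++H U (U ∷ D ∷ D ∷ P)   r = refl
  startsUUDD-++H U (U ∷ D ∷ H ∷ P)   r = refl

  occUUDD-++H : ∀ P r → occUUDD (P ++ H ∷ r) ≡ occUUDD P + occUUDD r
  occUUDD-++H []      r = refl
  occUUDD-++H (s ∷ P) r = begin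
    occUUDD (s ∷ P ++ H ∷ r)                        ≡⟨ occUUDD-∷ s (P ++ H ∷ r) ⟩
    startsUUDD (s ∷ P ++ H ∷ r) + occUUDD (P ++ H ∷ r) ≡⟨ cong₂ _+_ (startsUUDD-++H s P r) (occUUDD-++H P r) ⟩
    startsUUDD (s ∷ P) + (occUUDD P + occUUDD r)     ≡⟨ sym (+-assoc (startsUUDD (s ∷ P)) _ _) ⟩
    startsUUDD (s ∷ P) + occUUDD P + occUUDD r       ≡⟨ cong (_+ occUUDD r) (sym (occUUDD-∷ s P)) ⟩
    occUUDD (s ∷ P) + occUUDD r                      ∎

  dyckFrom-∷ : ∀ h s P → dyckFrom h (s ∷ P) ≡ true → Σ ℕ (λ h′ → dyckFrom h′ P ≡ true)
  dyckFrom-∷ h       U P isDyckFrom = suc h , isDyckFrom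
  dyckFrom-∷ (suc h) D P isDyckFrom = h , isDyckFrom

  -- Only U ∷ U ∷ [] and U ∷ U ∷ D ∷ [] would gain an occurrence; neither returns to the axis.
  startsUUDD-++D : ∀ h s P r → dyckFrom h (s ∷ P) ≡ true →
                   startsUUDD (s ∷ P ++ D ∷ r) ≡ startsUUDD (s ∷ P)
  startsUUDD-++D h D P                 r _  = refl
  startsUUDD-++D h H P                 r _  = refl
  startsUUDD-++D h U []                r _  = refl
  startsUUDD-++D h U (D ∷ P)           r _  = refl
  startsUUDD-++D h U (H ∷ P)           r _  = refl
  startsUUDD-++D h U (U ∷ [])          r ()
  startsUUDD-++D h U (U ∷ U ∷ P)       r _  = refl
  startsUUDD-++D h U (U ∷ H ∷ P)       r _  = refl
  startsUUDD-++D h U (U ∷ D ∷ [])      r ()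
  startsUUDD-++D h U (U ∷ D ∷ U ∷ P)   r _  = refl
  startsUUDD-++D h U (U ∷ D ∷ D ∷ P)   r _  = refl
  startsUUDD-++D h U (U ∷ D ∷ H ∷ P)   r _  = refl

  occUUDD-++D : ∀ h P r → dyckFrom h P ≡ true → occUUDD (P ++ D ∷ r) ≡ occUUDD P + occUUDD r
  occUUDD-++D h []      r _          = refl
  occUUDD-++D h (s ∷ P) r isDyckFrom with dyckFrom-∷ h s P isDyckFrom
  ... | h′ , isDyckFrom′ = begin
    occUUDD (s ∷ P ++ D ∷ r)                          ≡⟨ occUUDD-∷ s (P ++ D ∷ r) ⟩
    startsUUDD (s ∷ P ++ D ∷ r) + occUUDD (P ++ D ∷ r) ≡⟨ cong₂ _+_ (startsUUDD-++D h s P r isDyckFrom)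
                                                                     (occUUDD-++D h′ P r isDyckFrom′) ⟩
    startsUUDD (s ∷ P) + (occUUDD P + occUUDD r)       ≡⟨ sym (+-assoc (startsUUDD (s ∷ P)) _ _) ⟩
    startsUUDD (s ∷ P) + occUUDD P + occUUDD r         ≡⟨ cong (_+ occUUDD r) (sym (occUUDD-∷ s P)) ⟩
    occUUDD (s ∷ P) + occUUDD r                        ∎

  isUD : List Step → ℕ
  isUD (U ∷ D ∷ []) = 1
  isUD _            = 0

  isUD-≢2 : ∀ P → length P ≢ 2 → isUD P ≡ 0
  isUD-≢2 []                len≢2 = refl
  isUD-≢2 (D ∷ P)           len≢2 = refl
  isUD-≢2 (H ∷ P)           len≢2 = refl
  isUD-≢2 (U ∷ [])          len≢2 = refl
  isUD-≢2 (U ∷ U ∷ P)       len≢2 = refl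
  isUD-≢2 (U ∷ H ∷ P)       len≢2 = refl
  isUD-≢2 (U ∷ D ∷ [])      len≢2 = ⊥-elim (len≢2 refl)
  isUD-≢2 (U ∷ D ∷ _ ∷ P)   len≢2 = refl

  occElevated : List Step → ℕ
  occElevated P = isUD P + occUUDD P

  startsUUDD-return : ∀ P r → isDyck P ≡ true → startsUUDD (U ∷ P ++ D ∷ r) ≡ isUD P
  startsUUDD-return []              r _ = refl
  startsUUDD-return (U ∷ U ∷ P)     r _ = refl
  startsUUDD-return (U ∷ H ∷ P)     r _ = refl
  startsUUDD-return (U ∷ D ∷ [])    r _ = refl
  startsUUDD-return (U ∷ D ∷ U ∷ P) r _ = refl

  occUUDD-return : ∀ P r → isDyck P ≡ true → occUUDD (U ∷ P ++ D ∷ r) ≡ occElevated P + occUUDD r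
  occUUDD-return P r isDyckP = begin
    occUUDD (U ∷ P ++ D ∷ r)                          ≡⟨ occUUDD-∷ U (P ++ D ∷ r) ⟩
    startsUUDD (U ∷ P ++ D ∷ r) + occUUDD (P ++ D ∷ r) ≡⟨ cong₂ _+_ (startsUUDD-return P r isDyckP)
                                                                     (occUUDD-++D 0 P r isDyckP) ⟩
    isUD P + (occUUDD P + occUUDD r)                   ≡⟨ sym (+-assoc (isUD P) _ _) ⟩
    occElevated P + occUUDD r                          ∎

  -- δ a is the coefficient sequence of tᵃ, and δ-+ says tᵃ⁺ᵇ = tᵃ · tᵇ.
  δ : ℕ → ℕ → ℕ
  δ a k = if a ≡ᵇ k then 1 else 0

  δ-+ : ∀ a b k → δ (a + b) k ≡ ∑≤ k (λ l → δ a l * δ b (k ∸ l))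
  δ-+ zero    b zero    = sym (+-identityʳ (δ b 0))
  δ-+ zero    b (suc k) = begin
    δ b (suc k)
      ≡⟨ sym (trans (cong₂ _+_ (+-identityʳ _) (∑≤-zero k)) (+-identityʳ _)) ⟩
    δ b (suc k) + 0 + ∑≤ k (λ _ → 0)
      ≡⟨ sym (∑≤-suc k (λ l → δ 0 l * δ b (suc k ∸ l))) ⟩
    ∑≤ (suc k) (λ l → δ 0 l * δ b (suc k ∸ l)) ∎
  δ-+ (suc a) b zero    = refl
  δ-+ (suc a) b (suc k) = trans (δ-+ a b k) (sym (∑≤-suc k (λ l → δ (suc a) l * δ b (suc k ∸ l))))

  sumWhere-δ-product : ∀ i j α β (a c : List Step → ℕ) k →
    sumWhere i α (λ P → sumWhere j β (λ r → δ (a P + c r) k)) ≡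
    ∑≤ k (λ l → sumWhere i α (λ P → δ (a P) l) * sumWhere j β (λ r → δ (c r) (k ∸ l)))
  sumWhere-δ-product i j α β a c k = begin
    sumWhere i α (λ P → sumWhere j β (λ r → δ (a P + c r) k))
      ≡⟨ sumWhere-cong i α (λ P _ →
           trans (sumWhere-cong j β (λ r _ → δ-+ (a P) (c r) k)) (sumWhere-∑≤ j β k _)) ⟩
    sumWhere i α (λ P → ∑≤ k (λ l → sumWhere j β (λ r → δ (a P) l * δ (c r) (k ∸ l))))
      ≡⟨ sumWhere-∑≤ i α k _ ⟩
    ∑≤ k (λ l → sumWhere i α (λ P → sumWhere j β (λ r → δ (a P) l * δ (c r) (k ∸ l))))
      ≡⟨ ∑≤-cong k (λ l → sumWhere-product i j α β (λ P → δ (a P) l) (λ r → δ (c r) (k ∸ l))) ⟩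
    ∑≤ k (λ l → sumWhere i α (λ P → δ (a P) l) * sumWhere j β (λ r → δ (c r) (k ∸ l))) ∎

  sumWhere-+-product : ∀ i j α β (a c : List Step → ℕ) →
    sumWhere i α (λ P → sumWhere j β (λ r → a P + c r)) ≡
    sumWhere i α a * sumWhere j β (λ _ → 1) + sumWhere i α (λ _ → 1) * sumWhere j β c
  sumWhere-+-product i j α β a c = begin
    sumWhere i α (λ P → sumWhere j β (λ r → a P + c r))
      ≡⟨ sumWhere-cong i α (λ P _ → trans (sumWhere-cong j β (λ r _ →
           cong₂ _+_ (sym (*-identityʳ (a P))) (sym (*-identityˡ (c r))))) (sumWhere-+ j β _ _)) ⟩
    sumWhere i α (λ P → sumWhere j β (λ r → a P * 1) + sumWhere j β (λ r → 1 * c r))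
      ≡⟨ sumWhere-+ i α _ _ ⟩
    sumWhere i α (λ P → sumWhere j β (λ r → a P * 1)) + sumWhere i α (λ P → sumWhere j β (λ r → 1 * c r))
      ≡⟨ cong₂ _+_ (sumWhere-product i j α β a (λ _ → 1)) (sumWhere-product i j α β (λ _ → 1) c) ⟩
    sumWhere i α a * sumWhere j β (λ _ → 1) + sumWhere i α (λ _ → 1) * sumWhere j β c ∎

  dyckCount elevatedCount dispersedCount : ℕ → ℕ → ℕ
  dyckCount      n k = sumWhere n isDyck      (λ p → δ (occUUDD p) k)
  elevatedCount  n k = sumWhere n isDyck      (λ p → δ (occElevated p) k)
  dispersedCount n k = sumWhere n isDispersed (λ p → δ (occUUDD p) k)

  w≡dispersedCount : ∀ n k → w n k ≡ dispersedCount n k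
  w≡dispersedCount n k = sumList-cong (allWords n) (λ p → if-∧ (isDispersed p))

  dyckCount-return : ∀ n k →
    dyckCount (2 + n) k ≡ ∑≤ n (λ i → ∑≤ k (λ l → elevatedCount i l * dyckCount (n ∸ i) (k ∸ l)))
  dyckCount-return n k = begin
    dyckCount (2 + n) k
      ≡⟨ first-return (suc n) (λ p → δ (occUUDD p) k) ⟩
    ∑≤ n (λ i → sumWhere i isDyck (λ P →
                  sumWhere (n ∸ i) isDyck (λ r → δ (occUUDD (U ∷ P ++ D ∷ r)) k)))
      ≡⟨ ∑≤-cong n (λ i → sumWhere-cong i isDyck (λ P isDyckP → sumWhere-cong (n ∸ i) isDyck (λ r _ →
           cong (λ m → δ m k) (occUUDD-return P r isDyckP)))) ⟩
    ∑≤ n (λ i → sumWhere i isDyck (λ P → sumWhere (n ∸ i) isDyck (λ r → δ (occElevated P + occUUDD r) k)))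
      ≡⟨ ∑≤-cong n (λ i → sumWhere-δ-product i (n ∸ i) isDyck isDyck occElevated occUUDD k) ⟩
    ∑≤ n (λ i → ∑≤ k (λ l → elevatedCount i l * dyckCount (n ∸ i) (k ∸ l))) ∎

  dispersedCount-flat : ∀ n k → dispersedCount (suc n) k ≡
    dyckCount (suc n) k + ∑≤ n (λ i → ∑≤ k (λ l → dyckCount i l * dispersedCount (n ∸ i) (k ∸ l)))
  dispersedCount-flat n k = begin
    dispersedCount (suc n) k
      ≡⟨ first-flat (suc n) 0 (λ p → δ (occUUDD p) k) ⟩
    dyckCount (suc n) k
      + ∑≤ n (λ i → sumWhere i isDyck (λ P →
                      sumWhere (n ∸ i) isDispersed (λ r → δ (occUUDD (P ++ H ∷ r)) k)))
      ≡⟨ cong (dyckCount (suc n) k +_) (∑≤-cong n (λ i → sumWhere-cong i isDyck (λ P _ →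
           sumWhere-cong (n ∸ i) isDispersed (λ r _ → cong (λ m → δ m k) (occUUDD-++H P r))))) ⟩
    dyckCount (suc n) k
      + ∑≤ n (λ i → sumWhere i isDyck (λ P →
                      sumWhere (n ∸ i) isDispersed (λ r → δ (occUUDD P + occUUDD r) k)))
      ≡⟨ cong (dyckCount (suc n) k +_)
           (∑≤-cong n (λ i → sumWhere-δ-product i (n ∸ i) isDyck isDispersed occUUDD occUUDD k)) ⟩
    dyckCount (suc n) k + ∑≤ n (λ i → ∑≤ k (λ l → dyckCount i l * dispersedCount (n ∸ i) (k ∸ l))) ∎

  elevatedCount-≢2 : ∀ n k → n ≢ 2 → elevatedCount n k ≡ dyckCount n k
  elevatedCount-≢2 n k n≢2 = sumWords-length n (λ p len≡n →
    cong (λ m → if isDyck p then δ (m + occUUDD p) k else 0)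
         (isUD-≢2 p (λ len≡2 → n≢2 (trans (sym len≡n) len≡2))))

  dyckNumber dyckTotal elevatedTotal dispersedNumber : ℕ → ℕ
  dyckNumber      n = sumWhere n isDyck      (λ _ → 1)
  dyckTotal       n = sumWhere n isDyck      occUUDD
  elevatedTotal   n = sumWhere n isDyck      occElevated
  dispersedNumber n = sumWhere n isDispersed (λ _ → 1)

  dyckNumber-return : ∀ n → dyckNumber (2 + n) ≡ ∑≤ n (λ i → dyckNumber i * dyckNumber (n ∸ i))
  dyckNumber-return n = trans (first-return (suc n) (λ _ → 1))
    (∑≤-cong n (λ i → sumWhere-product i (n ∸ i) isDyck isDyck (λ _ → 1) (λ _ → 1)))

  dyckTotal-return : ∀ n → dyckTotal (2 + n) ≡
    ∑≤ n (λ i → elevatedTotal i * dyckNumber (n ∸ i)) + ∑≤ n (λ i → dyckNumber i * dyckTotal (n ∸ i))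
  dyckTotal-return n = begin
    dyckTotal (2 + n)
      ≡⟨ first-return (suc n) occUUDD ⟩
    ∑≤ n (λ i → sumWhere i isDyck (λ P → sumWhere (n ∸ i) isDyck (λ r → occUUDD (U ∷ P ++ D ∷ r))))
      ≡⟨ ∑≤-cong n (λ i → trans
           (sumWhere-cong i isDyck (λ P isDyckP →
              sumWhere-cong (n ∸ i) isDyck (λ r _ → occUUDD-return P r isDyckP)))
           (sumWhere-+-product i (n ∸ i) isDyck isDyck occElevated occUUDD)) ⟩
    ∑≤ n (λ i → elevatedTotal i * dyckNumber (n ∸ i) + dyckNumber i * dyckTotal (n ∸ i))
      ≡⟨ ∑≤-distrib-+ n _ _ ⟩
    ∑≤ n (λ i → elevatedTotal i * dyckNumber (n ∸ i)) + ∑≤ n (λ i → dyckNumber i * dyckTotal (n ∸ i)) ∎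

  dispersedNumber-flat : ∀ n → dispersedNumber (suc n) ≡
    dyckNumber (suc n) + ∑≤ n (λ i → dyckNumber i * dispersedNumber (n ∸ i))
  dispersedNumber-flat n = trans (first-flat (suc n) 0 (λ _ → 1)) (cong (dyckNumber (suc n) +_)
    (∑≤-cong n (λ i → sumWhere-product i (n ∸ i) isDyck isDispersed (λ _ → 1) (λ _ → 1))))

  totalUUDD-flat : ∀ n → totalUUDD (suc n) ≡ dyckTotal (suc n) +
    (∑≤ n (λ i → dyckTotal i * dispersedNumber (n ∸ i)) + ∑≤ n (λ i → dyckNumber i * totalUUDD (n ∸ i)))
  totalUUDD-flat n = begin
    totalUUDD (suc n)
      ≡⟨ first-flat (suc n) 0 occUUDD ⟩
    dyckTotal (suc n)
      + ∑≤ n (λ i → sumWhere i isDyck (λ P → sumWhere (n ∸ i) isDispersed (λ r → occUUDD (P ++ H ∷ r))))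
      ≡⟨ cong (dyckTotal (suc n) +_) (∑≤-cong n (λ i → trans
           (sumWhere-cong i isDyck (λ P _ → sumWhere-cong (n ∸ i) isDispersed (λ r _ → occUUDD-++H P r)))
           (sumWhere-+-product i (n ∸ i) isDyck isDispersed occUUDD occUUDD))) ⟩
    dyckTotal (suc n) + ∑≤ n (λ i → dyckTotal i * dispersedNumber (n ∸ i) + dyckNumber i * totalUUDD (n ∸ i))
      ≡⟨ cong (dyckTotal (suc n) +_) (∑≤-distrib-+ n _ _) ⟩
    dyckTotal (suc n)
      + (∑≤ n (λ i → dyckTotal i * dispersedNumber (n ∸ i))
         + ∑≤ n (λ i → dyckNumber i * totalUUDD (n ∸ i))) ∎

  elevatedTotal-≢2 : ∀ n → n ≢ 2 → elevatedTotal n ≡ dyckTotal n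
  elevatedTotal-≢2 n n≢2 = sumWords-length n (λ p len≡n →
    cong (λ m → if isDyck p then m + occUUDD p else 0)
         (isUD-≢2 p (λ len≡2 → n≢2 (trans (sym len≡n) len≡2))))

open Counting

open import Data.Bool.Properties using (if-∧; if-float; if-cong-then)
open import Data.Integer.Base as ℤ using (ℤ; +_)
import Data.Integer.Properties as ℤ
open import Data.Maybe.Base using (just; nothing)
open import Relation.Binary.Definitions using (WeaklyDecidable)
open import Relation.Nullary.Decidable.Core using (yes; no)

module IntegerCoefficients {c ℓ} (R : CommutativeRing c ℓ)
  (ι : ℤ.+-*-rawRing -Raw-AlmostCommutative⟶ fromCommutativeRing R) where

  open CommutativeRing R
  open import Relation.Binary.Reasoning.Setoid setoid
  open import Algebra.Properties.Semiring.Exp semiring using (_^_)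
  open import Algebra.Properties.Group +-group using (x≈y⇒x∙y⁻¹≈ε)

  [_] : ℤ → Carrier
  [_] = _-Raw-AlmostCommutative⟶_.⟦_⟧ ι

  ≟-induced : WeaklyDecidable (Induced-equivalence ι)
  ≟-induced x y with x ℤ.≟ y
  ... | yes ≡.refl = just refl
  ... | no _       = nothing

  module Solver = Algebra.Solver.Ring ℤ.+-*-rawRing (fromCommutativeRing R) ι ≟-induced
  open Solver using (Polynomial; var; _:^_)

  -- The polynomial syntax has no constant 1#, but x ^ 0 evaluates to 1# definitionally.
  𝟏 : ∀ {n} → Polynomial (suc n)
  𝟏 = var Fin.zero :^ 0

  modulo : ∀ {a b k x y} → a ≈ b + k * (x - y) → x ≈ y → a ≈ b
  modulo {a} {b} {k} {x} {y} a≈b+k[x-y] x≈y = begin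
    a               ≈⟨ a≈b+k[x-y] ⟩
    b + k * (x - y) ≈⟨ +-congˡ (trans (*-congˡ (x≈y⇒x∙y⁻¹≈ε x≈y)) (zeroʳ k)) ⟩
    b + 0#          ≈⟨ +-identityʳ b ⟩
    b               ∎

  module Joint (z t : Carrier) where

    monomial : ℤ → ℕ → ℕ → Carrier
    monomial c a b = [ c ] * (z ^ a * t ^ b)

    numerator denominator discriminant : Carrier
    numerator    = monomial m1 4 0 + monomial m1 0 0 + monomial (+ 1) 4 1 + monomial (+ 2) 1 0
    denominator  = monomial m2 5 1 + monomial (+ 2) 1 0 + monomial m4 2 0 + monomial (+ 2) 5 0
    discriminant = monomial (+ 1) 8 0 + monomial m2 8 1 + monomial (+ 2) 4 0 + monomial (+ 1) 8 2
                   + monomial m2 4 1 + monomial (+ 1) 0 0 + monomial m4 2 0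

    √discriminant : Carrier → Carrier
    √discriminant B = 1# + z ^ 4 - z ^ 4 * t - [ + 2 ] * z ^ 2 * B

    √discriminant≈1 : ∀ {B} → z ≈ 0# → √discriminant B ≈ 1#
    √discriminant≈1 {B} z≈0 = begin
      √discriminant B
        ≈⟨ solve 3 (λ z t B →
             𝟏 :+ z :^ 4 :- z :^ 4 :* t :- con (+ 2) :* z :^ 2 :* B
               := 𝟏 :+ z :* (z :^ 3 :- z :^ 3 :* t :- con (+ 2) :* z :* B)) refl z t B ⟩
      1# + z * (z ^ 3 - z ^ 3 * t - [ + 2 ] * z * B)
        ≈⟨ +-congˡ (trans (*-congʳ z≈0) (zeroˡ _)) ⟩
      1# + 0#
        ≈⟨ +-identityʳ 1# ⟩
      1# ∎
      where open Solver

    quadratic : ∀ {B B′} → B ≈ 1# + z ^ 2 * (B′ * B) → B′ ≈ B + z ^ 2 * (t - 1#) →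
                B ≈ 1# + z ^ 2 * (B * B) + z ^ 4 * (t - 1#) * B
    quadratic {B} {B′} eqB eqB′ = modulo (modulo (solve 4
      (λ z t B B′ →
         B := (𝟏 :+ z :^ 2 :* (B :* B) :+ z :^ 4 :* (t :- 𝟏) :* B
               :+ 𝟏 :* (B :- (𝟏 :+ z :^ 2 :* (B′ :* B))))
              :+ z :^ 2 :* B :* (B′ :- (B :+ z :^ 2 :* (t :- 𝟏))))
      refl z t B B′) eqB′) eqB
      where open Solver

    √discriminant-squared : ∀ {B} → B ≈ 1# + z ^ 2 * (B * B) + z ^ 4 * (t - 1#) * B →
                            √discriminant B * √discriminant B ≈ discriminant
    √discriminant-squared {B} eqB = modulo (solve 3
      (λ z t B →
         let m = λ c a b → con c :* (z :^ a :* t :^ b)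
             S = 𝟏 :+ z :^ 4 :- z :^ 4 :* t :- con (+ 2) :* z :^ 2 :* B
         in S :* S := m (+ 1) 8 0 :+ m m2 8 1 :+ m (+ 2) 4 0 :+ m (+ 1) 8 2 :+ m m2 4 1 :+ m (+ 1) 0 0 :+ m m4 2 0
                      :+ con m4 :* z :^ 2 :* (B :- (𝟏 :+ z :^ 2 :* (B :* B) :+ z :^ 4 :* (t :- 𝟏) :* B)))
      refl z t B) eqB
      where open Solver

    denominator*F : ∀ {B F} → B ≈ 1# + z ^ 2 * (B * B) + z ^ 4 * (t - 1#) * B → F ≈ B + z * (B * F) →
                    denominator * F ≈ numerator + √discriminant B
    denominator*F {B} {F} eqB eqF = modulo (modulo (solve 4
      (λ z t B F →
         let m = λ c a b → con c :* (z :^ a :* t :^ b)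
             S = 𝟏 :+ z :^ 4 :- z :^ 4 :* t :- con (+ 2) :* z :^ 2 :* B
         in (m m2 5 1 :+ m (+ 2) 1 0 :+ m m4 2 0 :+ m (+ 2) 5 0) :* F
              := (m m1 4 0 :+ m m1 0 0 :+ m (+ 1) 4 1 :+ m (+ 2) 1 0 :+ S
                  :+ con (+ 2) :* z :* (𝟏 :+ z :* F)
                     :* (B :- (𝟏 :+ z :^ 2 :* (B :* B) :+ z :^ 4 :* (t :- 𝟏) :* B)))
                 :+ con (+ 2) :* z :* (𝟏 :+ z :^ 4 :- z :^ 4 :* t :- z :- z :^ 2 :* B)
                    :* (F :- (B :+ z :* (B :* F))))
      refl z t B F) eqF) eqB
      where open Solver

  module Total (z : Carrier) where

    monomial : ℤ → ℕ → Carrier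
    monomial c a = [ c ] * z ^ a

    √1-4z² : Carrier → Carrier
    √1-4z² C = 1# - [ + 2 ] * z ^ 2 * C

    √1-4z²-squared : ∀ {C} → C ≈ 1# + z ^ 2 * (C * C) →
                     √1-4z² C * √1-4z² C ≈ monomial (+ 1) 0 + monomial m4 2
    √1-4z²-squared {C} eqC = modulo (solve 2
      (λ z C →
         let Q = 𝟏 :- con (+ 2) :* z :^ 2 :* C
         in Q :* Q := con (+ 1) :* z :^ 0 :+ con m4 :* z :^ 2
                      :+ con m4 :* z :^ 2 :* (C :- (𝟏 :+ z :^ 2 :* (C :* C))))
      refl z C) eqC
      where open Solver

    [1-zC][1+zF₁]≈1 : ∀ {C F₁} → F₁ ≈ C + z * (C * F₁) → (1# - z * C) * (1# + z * F₁) ≈ 1#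
    [1-zC][1+zF₁]≈1 {C} {F₁} eqF₁ = modulo (solve 3
      (λ z C F₁ → (𝟏 :- z :* C) :* (𝟏 :+ z :* F₁) := 𝟏 :+ z :* (F₁ :- (C :+ z :* (C :* F₁))))
      refl z C F₁) eqF₁
      where open Solver

    [1-zC]²≈[1-2z]C : ∀ {C} → C ≈ 1# + z ^ 2 * (C * C) → (1# - z * C) * (1# - z * C) ≈ (1# - [ + 2 ] * z) * C
    [1-zC]²≈[1-2z]C {C} eqC = modulo (solve 2
      (λ z C → (𝟏 :- z :* C) :* (𝟏 :- z :* C)
                 := (𝟏 :- con (+ 2) :* z) :* C :+ con m1 :* (C :- (𝟏 :+ z :^ 2 :* (C :* C))))
      refl z C) eqC
      where open Solver

    Bₜ*√1-4z² : ∀ {C Bₜ Bₜ′} → Bₜ ≈ z ^ 2 * (Bₜ′ * C + C * Bₜ) → Bₜ′ ≈ Bₜ + z ^ 2 →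
                Bₜ * √1-4z² C ≈ z ^ 4 * C
    Bₜ*√1-4z² {C} {Bₜ} {Bₜ′} eqBₜ eqBₜ′ = modulo (modulo (solve 4
      (λ z C Bₜ Bₜ′ → Bₜ :* (𝟏 :- con (+ 2) :* z :^ 2 :* C)
                        := (z :^ 4 :* C :+ 𝟏 :* (Bₜ :- z :^ 2 :* (Bₜ′ :* C :+ C :* Bₜ)))
                           :+ z :^ 2 :* C :* (Bₜ′ :- (Bₜ :+ z :^ 2)))
      refl z C Bₜ Bₜ′) eqBₜ′) eqBₜ
      where open Solver

    Fₜ*[1-zC] : ∀ {C F₁ Bₜ Fₜ} → Fₜ ≈ Bₜ + z * (Bₜ * F₁ + C * Fₜ) →
                Fₜ * (1# - z * C) ≈ Bₜ * (1# + z * F₁)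
    Fₜ*[1-zC] {C} {F₁} {Bₜ} {Fₜ} eqFₜ = modulo (solve 5
      (λ z C F₁ Bₜ Fₜ → Fₜ :* (𝟏 :- z :* C)
                          := Bₜ :* (𝟏 :+ z :* F₁) :+ 𝟏 :* (Fₜ :- (Bₜ :+ z :* (Bₜ :* F₁ :+ C :* Fₜ))))
      refl z C F₁ Bₜ Fₜ) eqFₜ
      where open Solver

    -- With u = 1 - zC, v = 1 + zF₁ and Q = √1-4z² C:
    -- (1-2z)QFₜ·uv = (1-2z)Q·Bₜ·v² = (1-2z)z⁴C·v² = z⁴u²v² = z⁴.
    [1-2z]*√1-4z²*Fₜ : ∀ {C F₁ Bₜ Fₜ} →
      (1# - z * C) * (1# + z * F₁) ≈ 1# → Bₜ * √1-4z² C ≈ z ^ 4 * C →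
      Fₜ * (1# - z * C) ≈ Bₜ * (1# + z * F₁) → (1# - z * C) * (1# - z * C) ≈ (1# - [ + 2 ] * z) * C →
      (monomial (+ 1) 0 + monomial m2 1) * √1-4z² C * Fₜ ≈ monomial (+ 1) 4
    [1-2z]*√1-4z²*Fₜ {C} {F₁} {Bₜ} {Fₜ} uv≈1 BₜQ≈z⁴C Fₜu≈Bₜv u²≈[1-2z]C =
      modulo (modulo (modulo (modulo (solve 5
      (λ z C F₁ Bₜ Fₜ →
         let u = 𝟏 :- z :* C
             v = 𝟏 :+ z :* F₁
             Q = 𝟏 :- con (+ 2) :* z :^ 2 :* C
             A = (con (+ 1) :* z :^ 0 :+ con m2 :* z :^ 1) :* Q :* Fₜ
         in A := con (+ 1) :* z :^ 4
                 :+ (z :^ 4 :* (𝟏 :+ u :* v) :- A) :* (u :* v :- 𝟏)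
                 :+ (𝟏 :- con (+ 2) :* z) :* v :* v :* (Bₜ :* Q :- z :^ 4 :* C)
                 :+ (𝟏 :- con (+ 2) :* z) :* Q :* v :* (Fₜ :* u :- Bₜ :* v)
                 :+ con m1 :* z :^ 4 :* v :* v :* (u :* u :- (𝟏 :- con (+ 2) :* z) :* C))
      refl z C F₁ Bₜ Fₜ) u²≈[1-2z]C) Fₜu≈Bₜv) BₜQ≈z⁴C) uv≈1
      where open Solver

open import Relation.Binary.PropositionalEquality using (_≡_; refl; sym; trans; cong; cong₂; module ≡-Reasoning)

module ℤ[[z]]      = FormalPowerSeries ℤ.+-*-commutativeRing
module ℤ[[t]]      = ℤ[[z]]
module ℤ[[t]][[z]] = FormalPowerSeries ℤ[[t]].R[[X]]

module ℕ-sums      = RangeSums ℕ.+-*-commutativeSemiring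
module ℤ-sums      = RangeSums (CommutativeRing.commutativeSemiring ℤ.+-*-commutativeRing)
module ℤ[[t]]-sums = RangeSums (CommutativeRing.commutativeSemiring ℤ[[t]].R[[X]])

ι₁ : ℤ.+-*-rawRing -Raw-AlmostCommutative⟶ fromCommutativeRing ℤ[[z]].R[[X]]
ι₁ = ℤ[[z]].C-morphism (-raw-almostCommutative⟶ (fromCommutativeRing ℤ.+-*-commutativeRing))

ι₂ : ℤ.+-*-rawRing -Raw-AlmostCommutative⟶ fromCommutativeRing ℤ[[t]][[z]].R[[X]]
ι₂ = ℤ[[t]][[z]].C-morphism ι₁

sumTo≡∑≤ : ∀ n f → sumTo n f ≡ ℤ-sums.∑≤ n f
sumTo≡∑≤ zero    f = refl
sumTo≡∑≤ (suc n) f = cong (ℤ._+ f (suc n)) (sumTo≡∑≤ n f)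

sumTo-cong : ∀ n {f g} → (∀ i → f i ≡ g i) → sumTo n f ≡ sumTo n g
sumTo-cong n f≗g = trans (sumTo≡∑≤ n _) (trans (ℤ-sums.∑≤-cong n f≗g) (sym (sumTo≡∑≤ n _)))

∑≤-apply : ∀ n (F : ℕ → ℤ[[t]].PowerSeries) k →
           ℤ[[t]]-sums.∑≤ n F k ≡ ℤ-sums.∑≤ n (λ i → F i k)
∑≤-apply zero    F k = refl
∑≤-apply (suc n) F k = cong (ℤ._+ F (suc n) k) (∑≤-apply n F k)

⊗≡*ˢ : ∀ f g n → (f ⊗ g) n ≡ (f ℤ[[z]].*ˢ g) n
⊗≡*ˢ f g n = sumTo≡∑≤ n _

⊗₂≡*ˢ : ∀ f g n k → (f ⊗₂ g) n k ≡ (f ℤ[[t]][[z]].*ˢ g) n k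
⊗₂≡*ˢ f g n k = trans (sumTo≡∑≤ n _)
  (trans (ℤ-sums.∑≤-cong n (λ i → sumTo≡∑≤ k _))
         (sym (∑≤-apply n (λ i → f i ℤ[[t]].*ˢ g (n ∸ i)) k)))

+-∑≤ : ∀ n f → + ℕ-sums.∑≤ n f ≡ ℤ-sums.∑≤ n (λ i → + f i)
+-∑≤ zero    f = refl
+-∑≤ (suc n) f = trans (ℤ.pos-+ (ℕ-sums.∑≤ n f) (f (suc n))) (cong (ℤ._+ + f (suc n)) (+-∑≤ n f))

toℤ : (ℕ → ℕ) → ℤ[[z]].PowerSeries
toℤ x n = + x n

toℤ₂ : (ℕ → ℕ → ℕ) → ℤ[[t]][[z]].PowerSeries
toℤ₂ x n k = + x n k

+-convolution : ∀ x y n → + ℕ-sums.∑≤ n (λ i → x i ℕ.* y (n ∸ i)) ≡ (toℤ x ℤ[[z]].*ˢ toℤ y) n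
+-convolution x y n = trans (+-∑≤ n _) (ℤ-sums.∑≤-cong n (λ i → ℤ.pos-* (x i) (y (n ∸ i))))

+-convolution₂ : ∀ x y n k →
  + ℕ-sums.∑≤ n (λ i → ℕ-sums.∑≤ k (λ l → x i l ℕ.* y (n ∸ i) (k ∸ l)))
    ≡ (toℤ₂ x ℤ[[t]][[z]].*ˢ toℤ₂ y) n k
+-convolution₂ x y n k = trans (+-∑≤ n _)
  (trans (ℤ-sums.∑≤-cong n (λ i → +-convolution (x i) (y (n ∸ i)) k))
         (sym (∑≤-apply n (λ i → toℤ₂ x i ℤ[[t]].*ˢ toℤ₂ y (n ∸ i)) k)))

module JointSeries where

  open ℤ[[t]][[z]] using (X; C; ≈ˢ-+X^*ˢ; C*X^-coeff; C-^; C-*)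
  open CommutativeRing ℤ[[t]][[z]].R[[X]] renaming (refl to ≈-refl; sym to ≈-sym; trans to ≈-trans)
  open import Algebra.Properties.Semiring.Exp semiring using (_^_)
  open IntegerCoefficients ℤ[[t]][[z]].R[[X]] ι₂ using ([_])

  z t : Carrier
  z = X
  t = C ℤ[[t]].X

  open IntegerCoefficients.Joint ℤ[[t]][[z]].R[[X]] ι₂ z t

  B B′ F : Carrier
  B  = toℤ₂ dyckCount
  B′ = toℤ₂ elevatedCount
  F  = toℤ₂ dispersedCount

  B-equation : B ≈ 1# + z ^ 2 * (B′ * B)
  B-equation = ≈ˢ-+X^*ˢ 2 {B} {1#} {B′ * B} initial (λ n k → begin
    + dyckCount (2 ℕ.+ n) k  ≡⟨ cong +_ (dyckCount-return n k) ⟩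
    _                        ≡⟨ +-convolution₂ elevatedCount dyckCount n k ⟩
    (B′ * B) n k             ≡⟨ sym (ℤ.+-identityˡ _) ⟩
    + 0 ℤ.+ (B′ * B) n k     ∎)
    where
    open ≡-Reasoning
    initial : ∀ n → n ℕ.< 2 → B n ℤ[[t]].≈ˢ 1# n
    initial 0 _ zero    = refl
    initial 0 _ (suc k) = refl
    initial 1 _ k       = refl
    initial (suc (suc _)) (s≤s (s≤s ()))

  B′-equation : B′ ≈ B + z ^ 2 * (t - 1#)
  B′-equation =
    ≈ˢ-+X^*ˢ 2 {B′} {B} {t - 1#} (λ n n<2 k → cong +_ (elevatedCount-≢2 n k (ℕ.<⇒≢ n<2))) step
    where
    step : ∀ n k → B′ (2 ℕ.+ n) k ≡ B (2 ℕ.+ n) k ℤ.+ (t - 1#) n k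
    step zero    zero          = refl
    step zero    (suc zero)    = refl
    step zero    (suc (suc k)) = refl
    step (suc n) k = trans (cong +_ (elevatedCount-≢2 (3 ℕ.+ n) k (λ ()))) (sym (ℤ.+-identityʳ _))

  F-equation : F ≈ B + z * (B * F)
  F-equation = ≈-trans (≈ˢ-+X^*ˢ 1 {F} {B} {B * F} initial step)
                       (+-congˡ {B} (*-congʳ {B * F} (*-identityʳ z)))
    where
    initial : ∀ n → n ℕ.< 1 → F n ℤ[[t]].≈ˢ B n
    initial 0       _        k = refl
    initial (suc _) (s≤s ())
    step : ∀ n k → F (suc n) k ≡ B (suc n) k ℤ.+ (B * F) n k
    step n k = trans (cong +_ (dispersedCount-flat n k)) (trans (ℤ.pos-+ (dyckCount (suc n) k) _)
      (cong (ℤ._+_ (B (suc n) k)) (+-convolution₂ dyckCount dispersedCount n k)))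

  monomial≈C[ct^b]*z^a : ∀ c a b → monomial c a b ≈ C (ℤ[[t]].C c ℤ[[t]].*ˢ ℤ[[t]].X ℤ[[t]].^ˢ b) * z ^ a
  monomial≈C[ct^b]*z^a c a b = begin
    [ c ] * (z ^ a * t ^ b)                  ≈⟨ *-congˡ {[ c ]} (*-comm (z ^ a) (t ^ b)) ⟩
    [ c ] * (t ^ b * z ^ a)                  ≈⟨ ≈-sym (*-assoc [ c ] (t ^ b) (z ^ a)) ⟩
    [ c ] * t ^ b * z ^ a                    ≈⟨ *-congʳ {z ^ a} (*-congˡ {[ c ]} (C-^ ℤ[[t]].X b)) ⟩
    [ c ] * C (ℤ[[t]].X ℤ[[t]].^ˢ b) * z ^ a
      ≈⟨ *-congʳ {z ^ a} (≈-sym (C-* (ℤ[[t]].C c) (ℤ[[t]].X ℤ[[t]].^ˢ b))) ⟩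
    C (ℤ[[t]].C c ℤ[[t]].*ˢ ℤ[[t]].X ℤ[[t]].^ˢ b) * z ^ a ∎
    where open import Relation.Binary.Reasoning.Setoid setoid

  monomial-coeff : ∀ c a b → mono₂ c a b ≈ monomial c a b
  monomial-coeff c a b n k = begin
    mono₂ c a b n k
      ≡⟨ if-∧ (n ≡ᵇ a) ⟩
    (if n ≡ᵇ a then mono c b k else + 0)
      ≡⟨ if-cong-then (n ≡ᵇ a) (sym (ℤ[[t]].C*X^-coeff c b k)) ⟩
    (if n ≡ᵇ a then u k else + 0)
      ≡⟨ sym (if-float (λ v → v k) (n ≡ᵇ a) {u} {ℤ[[t]].0ˢ}) ⟩
    (if n ≡ᵇ a then u else ℤ[[t]].0ˢ) k
      ≡⟨ sym (C*X^-coeff u a n k) ⟩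
    (C u * z ^ a) n k
      ≡⟨ sym (monomial≈C[ct^b]*z^a c a b n k) ⟩
    monomial c a b n k ∎
    where
    open ≡-Reasoning
    u : ℤ[[t]].PowerSeries
    u = ℤ[[t]].C c ℤ[[t]].*ˢ ℤ[[t]].X ℤ[[t]].^ˢ b

  numPoly≈numerator : numPoly ≈ numerator
  numPoly≈numerator = +-cong (+-cong (+-cong
    (monomial-coeff m1 4 0) (monomial-coeff m1 0 0)) (monomial-coeff (+ 1) 4 1)) (monomial-coeff (+ 2) 1 0)

  denPoly≈denominator : denPoly ≈ denominator
  denPoly≈denominator = +-cong (+-cong (+-cong
    (monomial-coeff m2 5 1) (monomial-coeff (+ 2) 1 0)) (monomial-coeff m4 2 0)) (monomial-coeff (+ 2) 5 0)

  discPoly≈discriminant : discPoly ≈ discriminant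
  discPoly≈discriminant = +-cong (+-cong (+-cong (+-cong (+-cong (+-cong
    (monomial-coeff (+ 1) 8 0) (monomial-coeff m2 8 1)) (monomial-coeff (+ 2) 4 0)) (monomial-coeff (+ 1) 8 2))
    (monomial-coeff m2 4 1)) (monomial-coeff (+ 1) 0 0)) (monomial-coeff m4 2 0)

  f₀≈F : f₀ ≈ F
  f₀≈F n k = cong +_ (w≡dispersedCount n k)

  S : Carrier
  S = √discriminant B

  S-isSqrt : IsSqrt₂ S discPoly
  S-isSqrt = constantTerm , λ n k → trans (⊗₂≡*ˢ S S n k)
    (≈-trans (√discriminant-squared (quadratic B-equation B′-equation)) (≈-sym discPoly≈discriminant) n k)
    where
    -- The constant term of S is √discriminant over ℤ[[t]] at the constant terms, where z is 0.
    module AtZero = IntegerCoefficients.Joint ℤ[[t]].R[[X]] ι₁ (z 0) (t 0)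
    constantTerm : ∀ k → S 0 k ≡ (if k ≡ᵇ 0 then + 1 else + 0)
    constantTerm zero    = AtZero.√discriminant≈1 {B 0} (λ _ → refl) 0
    constantTerm (suc k) = AtZero.√discriminant≈1 {B 0} (λ _ → refl) (suc k)

  denPoly⊗₂f₀ : denPoly ⊗₂ f₀ ≋₂ numPoly ⊕₂ S
  denPoly⊗₂f₀ n k = trans (⊗₂≡*ˢ denPoly f₀ n k) (≈-trans (*-cong denPoly≈denominator f₀≈F)
    (≈-trans (denominator*F (quadratic B-equation B′-equation) F-equation)
             (+-congʳ (≈-sym numPoly≈numerator))) n k)

numPoly-t=0 : ∀ n → numPoly n 0 ≡ numPoly0 n
numPoly-t=0 0 = refl
numPoly-t=0 1 = refl
numPoly-t=0 2 = refl
numPoly-t=0 3 = refl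
numPoly-t=0 4 = refl
numPoly-t=0 (suc (suc (suc (suc (suc n))))) = refl

denPoly-t=0 : ∀ n → denPoly n 0 ≡ denPoly0 n
denPoly-t=0 0 = refl
denPoly-t=0 1 = refl
denPoly-t=0 2 = refl
denPoly-t=0 3 = refl
denPoly-t=0 4 = refl
denPoly-t=0 5 = refl
denPoly-t=0 (suc (suc (suc (suc (suc (suc n)))))) = refl

discPoly-t=0 : ∀ n → discPoly n 0 ≡ discPoly0 n
discPoly-t=0 0 = refl
discPoly-t=0 1 = refl
discPoly-t=0 2 = refl
discPoly-t=0 3 = refl
discPoly-t=0 4 = refl
discPoly-t=0 5 = refl
discPoly-t=0 6 = refl
discPoly-t=0 7 = refl
discPoly-t=0 8 = refl
discPoly-t=0 (suc (suc (suc (suc (suc (suc (suc (suc (suc n))))))))) = refl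

avoidingUUDD : ∃[ R ] (IsSqrt R discPoly0 × (denPoly0 ⊗ f₀at0 ≋ numPoly0 ⊕ R))
avoidingUUDD = R , (proj₁ S-isSqrt 0 , R⊗R) , denPoly0⊗f₀at0
  where
  open JointSeries using (S; S-isSqrt; denPoly⊗₂f₀)
  open ≡-Reasoning
  R : Series
  R n = S n 0
  -- Setting t = 0 commutes with ⊗₂ by definition, since sumTo 0 f = f 0.
  R⊗R : R ⊗ R ≋ discPoly0
  R⊗R n = trans (proj₂ S-isSqrt n 0) (discPoly-t=0 n)
  denPoly0⊗f₀at0 : denPoly0 ⊗ f₀at0 ≋ numPoly0 ⊕ R
  denPoly0⊗f₀at0 n = begin
    (denPoly0 ⊗ f₀at0) n ≡⟨ sumTo-cong n (λ i → cong (ℤ._* f₀at0 (n ∸ i)) (sym (denPoly-t=0 i))) ⟩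
    (denPoly ⊗₂ f₀) n 0  ≡⟨ denPoly⊗₂f₀ n 0 ⟩
    numPoly n 0 ℤ.+ R n  ≡⟨ cong (ℤ._+ R n) (numPoly-t=0 n) ⟩
    (numPoly0 ⊕ R) n     ∎

module TotalSeries where

  open ℤ[[z]] using (X; ≈ˢ-+X^*ˢ; C*X^-coeff)
  open CommutativeRing ℤ[[z]].R[[X]] renaming (refl to ≈-refl; sym to ≈-sym; trans to ≈-trans)
  open import Algebra.Properties.Semiring.Exp semiring using (_^_)

  z : Carrier
  z = X

  open IntegerCoefficients.Total ℤ[[z]].R[[X]] ι₁ z

  C Bₜ Bₜ′ F₁ Fₜ : Carrier
  C   = toℤ dyckNumber
  Bₜ  = toℤ dyckTotal
  Bₜ′ = toℤ elevatedTotal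
  F₁  = toℤ dispersedNumber
  Fₜ  = toℤ totalUUDD

  C-equation : C ≈ 1# + z ^ 2 * (C * C)
  C-equation = ≈ˢ-+X^*ˢ 2 {C} {1#} {C * C} initial (λ n →
    trans (cong +_ (dyckNumber-return n)) (trans (+-convolution dyckNumber dyckNumber n) (sym (ℤ.+-identityˡ _))))
    where
    initial : ∀ n → n ℕ.< 2 → C n ≡ 1# n
    initial 0 _ = refl
    initial 1 _ = refl
    initial (suc (suc _)) (s≤s (s≤s ()))

  Bₜ-equation : Bₜ ≈ z ^ 2 * (Bₜ′ * C + C * Bₜ)
  Bₜ-equation = ≈-trans (≈ˢ-+X^*ˢ 2 {Bₜ} {0#} {Bₜ′ * C + C * Bₜ} initial step) (+-identityˡ _)
    where
    initial : ∀ n → n ℕ.< 2 → Bₜ n ≡ 0# n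
    initial 0 _ = refl
    initial 1 _ = refl
    initial (suc (suc _)) (s≤s (s≤s ()))
    step : ∀ n → Bₜ (2 ℕ.+ n) ≡ + 0 ℤ.+ (Bₜ′ * C + C * Bₜ) n
    step n = trans (cong +_ (dyckTotal-return n)) (trans (ℤ.pos-+ elevatedPart _)
      (trans (cong₂ ℤ._+_ (+-convolution elevatedTotal dyckNumber n) (+-convolution dyckNumber dyckTotal n))
             (sym (ℤ.+-identityˡ _))))
      where
      elevatedPart : ℕ
      elevatedPart = ℕ-sums.∑≤ n (λ i → elevatedTotal i ℕ.* dyckNumber (n ∸ i))

  Bₜ′-equation = ≈-trans
    (≈ˢ-+X^*ˢ 2 {Bₜ′} {Bₜ} {1#} (λ n n<2 → cong +_ (elevatedTotal-≢2 n (ℕ.<⇒≢ n<2))) step)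
    (+-congˡ {Bₜ} (*-identityʳ (z ^ 2)))
    where
    step : ∀ n → Bₜ′ (2 ℕ.+ n) ≡ Bₜ (2 ℕ.+ n) ℤ.+ 1# n
    step zero    = refl
    step (suc n) = trans (cong +_ (elevatedTotal-≢2 (3 ℕ.+ n) (λ ()))) (sym (ℤ.+-identityʳ _))

  F₁-equation : F₁ ≈ C + z * (C * F₁)
  F₁-equation = ≈-trans (≈ˢ-+X^*ˢ 1 {F₁} {C} {C * F₁} initial step)
                        (+-congˡ {C} (*-congʳ {C * F₁} (*-identityʳ z)))
    where
    initial : ∀ n → n ℕ.< 1 → F₁ n ≡ C n
    initial 0       _        = refl
    initial (suc _) (s≤s ())
    step : ∀ n → F₁ (suc n) ≡ C (suc n) ℤ.+ (C * F₁) n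
    step n = trans (cong +_ (dispersedNumber-flat n)) (trans (ℤ.pos-+ (dyckNumber (suc n)) _)
      (cong (ℤ._+_ (C (suc n))) (+-convolution dyckNumber dispersedNumber n)))

  Fₜ-equation : Fₜ ≈ Bₜ + z * (Bₜ * F₁ + C * Fₜ)
  Fₜ-equation = ≈-trans (≈ˢ-+X^*ˢ 1 {Fₜ} {Bₜ} {Bₜ * F₁ + C * Fₜ} initial step)
                        (+-congˡ {Bₜ} (*-congʳ {Bₜ * F₁ + C * Fₜ} (*-identityʳ z)))
    where
    initial : ∀ n → n ℕ.< 1 → Fₜ n ≡ Bₜ n
    initial 0       _        = refl
    initial (suc _) (s≤s ())
    step : ∀ n → Fₜ (suc n) ≡ Bₜ (suc n) ℤ.+ (Bₜ * F₁ + C * Fₜ) n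
    step n = trans (cong +_ (totalUUDD-flat n)) (trans (ℤ.pos-+ (dyckTotal (suc n)) _)
      (cong (ℤ._+_ (Bₜ (suc n))) (trans (ℤ.pos-+ dyckPart _)
        (cong₂ ℤ._+_ (+-convolution dyckTotal dispersedNumber n) (+-convolution dyckNumber totalUUDD n)))))
      where
      dyckPart : ℕ
      dyckPart = ℕ-sums.∑≤ n (λ i → dyckTotal i ℕ.* dispersedNumber (n ∸ i))

  monomial-coeff : ∀ c a → mono c a ≈ monomial c a
  monomial-coeff c a n = sym (C*X^-coeff c a n)

  Q : Carrier
  Q = √1-4z² C

  Q-isSqrt : IsSqrt Q oneMinus4z2
  Q-isSqrt = refl , λ n → trans (⊗≡*ˢ Q Q n)
    (≈-trans (√1-4z²-squared C-equation) (+-cong (≈-sym (monomial-coeff (+ 1) 0)) (≈-sym (monomial-coeff m4 2))) n)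

  oneMinus2z⊗Q⊗f₀dt1 : oneMinus2z ⊗ Q ⊗ f₀dt1 ≋ z⁴
  oneMinus2z⊗Q⊗f₀dt1 n = trans (⊗≡*ˢ (oneMinus2z ⊗ Q) f₀dt1 n) (≈-trans
    (*-congʳ {Fₜ} (λ m → trans (⊗≡*ˢ oneMinus2z Q m)
      (*-congʳ {Q} (+-cong (monomial-coeff (+ 1) 0) (monomial-coeff m2 1)) m)))
    (≈-trans ([1-2z]*√1-4z²*Fₜ {C} {F₁} {Bₜ} {Fₜ}
                ([1-zC][1+zF₁]≈1 {C} {F₁} F₁-equation)
                (Bₜ*√1-4z² {C} {Bₜ} {Bₜ′} Bₜ-equation Bₜ′-equation)
                (Fₜ*[1-zC] {C} {F₁} {Bₜ} {Fₜ} Fₜ-equation) ([1-zC]²≈[1-2z]C {C} C-equation))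
             (≈-sym (monomial-coeff (+ 1) 4))) n)

mainTheorem7 : (∃[ S ] (IsSqrt₂ S discPoly × (denPoly ⊗₂ f₀ ≋₂ numPoly ⊕₂ S)))
               × (∃[ R ] (IsSqrt R discPoly0 × (denPoly0 ⊗ f₀at0 ≋ numPoly0 ⊕ R)))
               × (∃[ Q ] (IsSqrt Q oneMinus4z2 × (oneMinus2z ⊗ Q ⊗ f₀dt1 ≋ z⁴)))
mainTheorem7 = (S , S-isSqrt , denPoly⊗₂f₀) , avoidingUUDD , (Q , Q-isSqrt , oneMinus2z⊗Q⊗f₀dt1)
  where
  open JointSeries using (S; S-isSqrt; denPoly⊗₂f₀)
  open TotalSeries using (Q; Q-isSqrt; oneMinus2z⊗Q⊗f₀dt1)
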